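{- For all $n\geqslant 0$, $0\leqslant i\leqslant n$ and $0\leqslant j\leqslant\lfloor (n-i)/2\rfloor$, the number $\gamma_{n,i,j}$ equals the number of simsun permutations of the second kind in $\mathfrak{S}_n$ having exactly $i$ fixed points and $j$ excedances.
   Context: The integers $\gamma_{n,i,j}$ are defined by $\gamma_{0,0,0}=1$, $\gamma_{0,i,j}=0$ for $(i,j)\neq(0,0)$, $\gamma_{n,i,j}=0$ if an index is negative, and $\gamma_{n+1,i,j}=\gamma_{n,i-1,j}+(1+i)\gamma_{n,i+1,j-1}+j\gamma_{n,i,j}+(n-i-2j+2)\gamma_{n,i,j-1}$. An excedance of $\pi$ is an index $i$ with $\pi(i)>i$. For a permutation $\pi$ of a finite set of positive integers, a value $a$ is a cycle double ascent if $\pi^{ -1}(a)<a<\pi(a)$. Removing a letter from a permutation means deleting it from its cycle in the cycle notation (the result is a permutation of the remaining letters). $\pi\in\mathfrak{S}_n$ is a simsun permutation of the second kind if for every $k\in\{0,1,\ldots,n-1\}$, the permutation obtained from $\pi$ by removing its $k$ largest letters has no cycle double ascents. (E.g. $(1,6,5,3,4)(2)$ is not, since removing $5,6$ gives $(1,3,4)(2)$ in which $3$ is a cycle double ascent.) -}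

module Defs where

open import Data.Bool using (Bool; true; false; if_then_else_; _∧_; not)
open import Data.Nat using (ℕ; zero; suc; _+_; _∸_; _*_; _≤ᵇ_; _<ᵇ_; _≡ᵇ_)
open import Data.List using (List; []; _∷_; map; concatMap; length; filterᵇ)
open import Data.Bool.ListAction using (all; any)
open import Data.Integer as ℤ using (ℤ; +_)

-- The integers γ n i j  (indices i, j ∈ ℕ; "negative index" terms are 0)

γprev-i : (ℕ → ℕ → ℤ) → ℕ → ℕ → ℤ
γprev-i g zero    j = + 0
γprev-i g (suc i) j = g i j

γ : ℕ → ℕ → ℕ → ℤ
γ zero zero zero = + 1
γ zero _    _    = + 0
γ (suc n) i zero =
  γprev-i (γ n) i zero
  ℤ.+ + zero ℤ.* γ n i zero
  -- the two terms with index j-1 = -1 vanish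
γ (suc n) i (suc j) =
  γprev-i (γ n) i (suc j)                    -- γ n (i-1) j
  ℤ.+ + (1 + i) ℤ.* γ n (suc i) j            -- (1+i) γ n (i+1) (j-1)
  ℤ.+ + (suc j) ℤ.* γ n i (suc j)            -- j γ n i j
  ℤ.+ (((+ n ℤ.- + i) ℤ.- + (2 * suc j)) ℤ.+ + 2) ℤ.* γ n i j
                                             -- (n-i-2j+2) γ n i (j-1)

-- Permutations of [n] = {1,…,n} in one-line notation: a list w of
-- length n with w[x-1] = π(x).

range : ℕ → List ℕ
range zero    = []
range (suc n) = range n Data.List.++ (suc n ∷ [])

words : ℕ → ℕ → List (List ℕ)
words n zero    = [] ∷ []
words n (suc m) = concatMap (λ a → map (a ∷_) (words n m)) (range n)

elem : ℕ → List ℕ → Bool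
elem a []       = false
elem a (b ∷ bs) = (a ≡ᵇ b) Data.Bool.∨ elem a bs

distinct : List ℕ → Bool
distinct []       = true
distinct (b ∷ bs) = not (elem b bs) ∧ distinct bs

perms : ℕ → List (List ℕ)
perms n = filterᵇ distinct (words n n)

app : List ℕ → ℕ → ℕ
app []       x             = x
app (b ∷ bs) zero          = zero
app (b ∷ bs) (suc zero)    = b
app (b ∷ bs) (suc (suc x)) = app bs (suc x)

-- The permutation of [m] obtained from w ∈ 𝔖ₙ by removing (from its
-- cycle notation) the letters m+1,…,n:  x ↦ first element of
-- π(x), π²(x), … that is ≤ m.  (fuel n suffices: cycles have length ≤ n)
restrictAt : List ℕ → ℕ → ℕ → ℕ → ℕ
restrictAt w m zero       y = y
restrictAt w m (suc fuel) y =
  if app w y ≤ᵇ m then app w y else restrictAt w m fuel (app w y)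

restrict : List ℕ → ℕ → ℕ → ℕ
restrict w m x = restrictAt w m (length w) x

-- a permutation σ of [m] (given as a function) has a cycle double
-- ascent: some a ∈ [m] with σ⁻¹(a) < a < σ(a)
hasCDA : ℕ → (ℕ → ℕ) → Bool
hasCDA m σ = any (λ a → any (λ b → (σ b ≡ᵇ a) ∧ (b <ᵇ a)) (range m) ∧ (a <ᵇ σ a)) (range m)

-- simsun permutation of the second kind: for every k ∈ {0,…,n-1},
-- removing the k largest letters leaves no cycle double ascents
isSimsun₂ : ℕ → List ℕ → Bool
isSimsun₂ n w = all (λ k → not (hasCDA (n ∸ k) (restrict w (n ∸ k)))) (Data.List.upTo n)

fix : ℕ → List ℕ → ℕ
fix n w = length (filterᵇ (λ x → app w x ≡ᵇ x) (range n))

exc : ℕ → List ℕ → ℕ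
exc n w = length (filterᵇ (λ x → x <ᵇ app w x) (range n))

simsun₂Count : ℕ → ℕ → ℕ → ℕ
simsun₂Count n i j =
  length (filterᵇ (λ w → isSimsun₂ n w ∧ (fix n w ≡ᵇ i) ∧ (exc n w ≡ᵇ j)) (perms n))

-- Every τ ∈ 𝔖ₙ₊₁ arises from exactly one σ ∈ 𝔖ₙ by inserting n + 1 into the cycle of σ
-- through x, right after x (x ∈ [1, n]), or as a new fixed point (x = 0). Removing the
-- letters above any m ≤ n from τ or from σ gives the same permutation, so τ is simsun of the
-- second kind iff σ is and τ has no cycle double ascent; for simsun σ the latter holds iff x = 0, σ(x) = x, or σ⁻¹(x) > x.
-- Inserting at 0 adds a fixed point, after a fixed point it trades it for an excedance,
-- after an excedance it changes nothing, and after a cycle double descent it adds an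
-- excedance. A simsun σ with i fixed points and j excedances has n - i - 2j cycle double
-- descents: every excedance x has σ⁻¹(x) > x, and y ↦ σ(y) maps the descents onto the letters
-- with a larger preimage. Counting insertions gives exactly the recurrence of γ.

module Submission where

open import Defs
open import Data.Bool using (Bool; true; false; if_then_else_; _∧_; _∨_; not; T)
open import Data.Bool.ListAction using (all; any)
open import Data.Bool.Properties using (∧-zeroʳ; ∧-identityʳ)
open import Data.Empty using (⊥; ⊥-elim)
open import Data.Integer as ℤ using (ℤ)
import Data.Integer.Properties as ℤₚ
import Data.Integer.Tactic.RingSolver as ℤ-Solver
open import Data.List using (List; []; _∷_; _++_; map; concatMap; length; filterᵇ; take; applyUpTo)
open import Data.List.Membership.Propositional using (_∈_; _∉_)
open import Data.List.Membership.Propositional.Properties using (∈-∃++; ∈-++⁺ˡ; ∈-++⁺ʳ; ∈-++⁻; ∈-map⁺; ∈-map⁻)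
open import Data.List.Properties using (length-++; length-map; ∷-injectiveʳ)
open import Data.List.Relation.Unary.Any using (here; there)
open import Data.Nat using (ℕ; zero; suc; _+_; _∸_; _*_; _/_; _≤_; _<_; z≤n; s≤s; _≤ᵇ_; _<ᵇ_; _≡ᵇ_; _≟_; _≤?_; _<?_)
open import Data.List.Membership.DecPropositional _≟_ using (_∈?_)
open import Data.Nat.Properties
open import Data.Nat.Tactic.RingSolver using (solve-∀)
open import Data.Product using (∃-syntax; _×_; _,_; proj₁; proj₂)
open import Data.Sum using (_⊎_; inj₁; inj₂; [_,_]′)
open import Data.Unit using (tt)
open import Function using (_∘_)
open import Relation.Binary.Definitions using (tri<; tri≈; tri>)
open import Relation.Binary.PropositionalEquality using (_≡_; _≢_; refl; sym; trans; cong; cong₂; subst; subst₂; module ≡-Reasoning)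
open import Relation.Nullary using (¬_; yes; no)

χ : Bool → ℕ
χ true  = 1
χ false = 0

∑ : {A : Set} → (A → ℕ) → List A → ℕ
∑ f []       = 0
∑ f (a ∷ as) = f a + ∑ f as

count : {A : Set} → (A → Bool) → List A → ℕ
count p = ∑ (λ a → χ (p a))

length-filterᵇ : {A : Set} (p : A → Bool) (xs : List A) → length (filterᵇ p xs) ≡ count p xs
length-filterᵇ p []       = refl
length-filterᵇ p (x ∷ xs) with p x
... | true  = cong suc (length-filterᵇ p xs)
... | false = length-filterᵇ p xs

χ-∧ : ∀ a b → χ (a ∧ b) ≡ χ a * χ b
χ-∧ true  b = sym (+-identityʳ (χ b))
χ-∧ false b = refl

χ-true : ∀ {b} → b ≡ true → χ b ≡ 1
χ-true refl = refl

χ-false : ∀ {b} → b ≡ false → χ b ≡ 0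
χ-false refl = refl

module _ {A : Set} where

  ∑-++ : (f : A → ℕ) (xs ys : List A) → ∑ f (xs ++ ys) ≡ ∑ f xs + ∑ f ys
  ∑-++ f []       ys = refl
  ∑-++ f (x ∷ xs) ys = trans (cong (f x +_) (∑-++ f xs ys)) (sym (+-assoc (f x) _ _))

  ∑-cong : (f g : A → ℕ) (xs : List A) → (∀ {a} → a ∈ xs → f a ≡ g a) → ∑ f xs ≡ ∑ g xs
  ∑-cong f g []       h = refl
  ∑-cong f g (x ∷ xs) h = cong₂ _+_ (h (here refl)) (∑-cong f g xs (h ∘ there))

  ∑-+ : (f g : A → ℕ) (xs : List A) → ∑ (λ a → f a + g a) xs ≡ ∑ f xs + ∑ g xs
  ∑-+ f g []       = refl
  ∑-+ f g (x ∷ xs) rewrite ∑-+ f g xs = interchange (f x) (g x) (∑ f xs) (∑ g xs)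
    where
    interchange : ∀ a b c d → a + b + (c + d) ≡ a + c + (b + d)
    interchange = solve-∀

  ∑-+⁴ : (f g h k : A → ℕ) (xs : List A) →
    ∑ (λ a → f a + (g a + (h a + k a))) xs ≡ ∑ f xs + (∑ g xs + (∑ h xs + ∑ k xs))
  ∑-+⁴ f g h k xs = trans (∑-+ f _ xs) (cong (∑ f xs +_) (trans (∑-+ g _ xs) (cong (∑ g xs +_) (∑-+ h k xs))))

  ∑-*ʳ : (f : A → ℕ) (c : ℕ) (xs : List A) → ∑ (λ a → f a * c) xs ≡ ∑ f xs * c
  ∑-*ʳ f c []       = refl
  ∑-*ʳ f c (x ∷ xs) rewrite ∑-*ʳ f c xs = sym (*-distribʳ-+ c (f x) (∑ f xs))

  ∑-zero : (f : A → ℕ) (xs : List A) → (∀ {a} → a ∈ xs → f a ≡ 0) → ∑ f xs ≡ 0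
  ∑-zero f []       h = refl
  ∑-zero f (x ∷ xs) h = cong₂ _+_ (h (here refl)) (∑-zero f xs (h ∘ there))

  ∑-const-1 : (xs : List A) → ∑ (λ _ → 1) xs ≡ length xs
  ∑-const-1 []       = refl
  ∑-const-1 (_ ∷ xs) = cong suc (∑-const-1 xs)

  ∑-middle : (f : A → ℕ) {a : A} (us vs : List A) → ∑ f (us ++ a ∷ vs) ≡ f a + ∑ f (us ++ vs)
  ∑-middle f []       vs = refl
  ∑-middle f {a} (x ∷ us) vs rewrite ∑-middle f {a} us vs = swap (f x) (f a) _
    where
    swap : ∀ b c d → b + (c + d) ≡ c + (b + d)
    swap = solve-∀

module _ {A B : Set} where

  ∑-map : (f : B → ℕ) (g : A → B) (xs : List A) → ∑ f (map g xs) ≡ ∑ (λ a → f (g a)) xs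
  ∑-map f g []       = refl
  ∑-map f g (x ∷ xs) = cong (f (g x) +_) (∑-map f g xs)

  ∑-concatMap : (f : B → ℕ) (g : A → List B) (xs : List A) →
    ∑ f (concatMap g xs) ≡ ∑ (λ a → ∑ f (g a)) xs
  ∑-concatMap f g []       = refl
  ∑-concatMap f g (x ∷ xs) = trans (∑-++ f (g x) (concatMap g xs)) (cong (∑ f (g x) +_) (∑-concatMap f g xs))

data Distinct {A : Set} : List A → Set where
  []  : Distinct []
  _∷_ : ∀ {a xs} → a ∉ xs → Distinct xs → Distinct (a ∷ xs)

module _ {A : Set} where

  _⊆_ : List A → List A → Set
  xs ⊆ ys = ∀ {a} → a ∈ xs → a ∈ ys

  ∉⇒≢ : {a b : A} {xs : List A} → a ∉ xs → b ∈ xs → b ≢ a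
  ∉⇒≢ a∉ b∈ refl = a∉ b∈

  ∈-middle⁻ : {a b : A} (us vs : List A) → b ∈ us ++ a ∷ vs → b ≢ a → b ∈ us ++ vs
  ∈-middle⁻ []       vs (here p)  b≢a = ⊥-elim (b≢a p)
  ∈-middle⁻ []       vs (there m) b≢a = m
  ∈-middle⁻ (u ∷ us) vs (here p)  b≢a = here p
  ∈-middle⁻ (u ∷ us) vs (there m) b≢a = there (∈-middle⁻ us vs m b≢a)

  ∈-middle⁺ : {a b : A} (us vs : List A) → b ∈ us ++ vs → b ∈ us ++ a ∷ vs
  ∈-middle⁺ us vs m with ∈-++⁻ us m
  ... | inj₁ q = ∈-++⁺ˡ q
  ... | inj₂ q = ∈-++⁺ʳ us (there q)

  distinct-middle⁻ : {a : A} (us vs : List A) → Distinct (us ++ a ∷ vs) → Distinct (us ++ vs) × a ∉ us ++ vs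
  distinct-middle⁻ []       vs (a∉ ∷ d) = d , a∉
  distinct-middle⁻ (x ∷ us) vs (x∉ ∷ d) with distinct-middle⁻ us vs d
  ... | d′ , a∉ = (λ m → x∉ (∈-middle⁺ us vs m)) ∷ d′
                , λ { (here refl) → x∉ (∈-++⁺ʳ us (here refl)) ; (there m) → a∉ m }

  length-middle : {a : A} (us vs : List A) → length (us ++ a ∷ vs) ≡ suc (length (us ++ vs))
  length-middle []       vs = refl
  length-middle (x ∷ us) vs = cong suc (length-middle us vs)

  length-mono-⊆ : (xs ys : List A) → Distinct xs → xs ⊆ ys → length xs ≤ length ys
  length-mono-⊆ []       ys d       sub = z≤n
  length-mono-⊆ (x ∷ xs) ys (x∉ ∷ d) sub with ∈-∃++ (sub (here refl))
  ... | us , vs , refl = subst (suc (length xs) ≤_) (sym (length-middle us vs))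
        (s≤s (length-mono-⊆ xs (us ++ vs) d (λ m → ∈-middle⁻ us vs (sub (there m)) (∉⇒≢ x∉ m))))

  ∑-sameElements : (f : A → ℕ) (xs ys : List A) → Distinct xs → Distinct ys → xs ⊆ ys → ys ⊆ xs →
    ∑ f xs ≡ ∑ f ys
  ∑-sameElements f []       []       _        _  _   _   = refl
  ∑-sameElements f []       (y ∷ ys) _        _  _   sup with sup (here refl)
  ... | ()
  ∑-sameElements f (x ∷ xs) ys       (x∉ ∷ d) dy sub sup with ∈-∃++ (sub (here refl))
  ... | us , vs , refl with distinct-middle⁻ us vs dy
  ... | dy′ , x∉′ = trans (cong (f x +_) (∑-sameElements f xs (us ++ vs) d dy′
                      (λ m → ∈-middle⁻ us vs (sub (there m)) (∉⇒≢ x∉ m))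
                      (λ m → fromTail m (sup (∈-middle⁺ us vs m)))))
                    (sym (∑-middle f us vs))
    where
    fromTail : ∀ {b} → b ∈ us ++ vs → b ∈ x ∷ xs → b ∈ xs
    fromTail m (here refl) = ⊥-elim (x∉′ m)
    fromTail m (there q)   = q

  distinct-++ : (xs ys : List A) → Distinct xs → Distinct ys → (∀ {a} → a ∈ xs → a ∉ ys) → Distinct (xs ++ ys)
  distinct-++ []       ys d        dy disj = dy
  distinct-++ (x ∷ xs) ys (x∉ ∷ d) dy disj =
    (λ m → [ x∉ , disj (here refl) ]′ (∈-++⁻ xs m)) ∷ distinct-++ xs ys d dy (λ m → disj (there m))

  ∈-filterᵇ⁺ : (p : A → Bool) {a : A} (xs : List A) → a ∈ xs → p a ≡ true → a ∈ filterᵇ p xs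
  ∈-filterᵇ⁺ p (x ∷ xs) (here refl) pa with p x
  ∈-filterᵇ⁺ p (x ∷ xs) (here refl) refl | .true = here refl
  ∈-filterᵇ⁺ p (x ∷ xs) (there m) pa with p x
  ... | true  = there (∈-filterᵇ⁺ p xs m pa)
  ... | false = ∈-filterᵇ⁺ p xs m pa

  ∈-filterᵇ⁻ : (p : A → Bool) {a : A} (xs : List A) → a ∈ filterᵇ p xs → a ∈ xs × p a ≡ true
  ∈-filterᵇ⁻ p (x ∷ xs) m with p x in eq
  ∈-filterᵇ⁻ p (x ∷ xs) (here refl) | true = here refl , eq
  ∈-filterᵇ⁻ p (x ∷ xs) (there m)   | true with ∈-filterᵇ⁻ p xs m
  ... | q , e = there q , e
  ∈-filterᵇ⁻ p (x ∷ xs) m | false with ∈-filterᵇ⁻ p xs m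
  ... | q , e = there q , e

  distinct-filterᵇ : (p : A → Bool) (xs : List A) → Distinct xs → Distinct (filterᵇ p xs)
  distinct-filterᵇ p []       d        = []
  distinct-filterᵇ p (x ∷ xs) (x∉ ∷ d) with p x
  ... | true  = (λ m → x∉ (proj₁ (∈-filterᵇ⁻ p xs m))) ∷ distinct-filterᵇ p xs d
  ... | false = distinct-filterᵇ p xs d

module _ {A B : Set} where

  distinct-map : (f : A → B) (xs : List A) → Distinct xs →
    (∀ {a b} → a ∈ xs → b ∈ xs → f a ≡ f b → a ≡ b) → Distinct (map f xs)
  distinct-map f []       d        inj = []
  distinct-map f (x ∷ xs) (x∉ ∷ d) inj = fx∉ ∷ distinct-map f xs d (λ a b e → inj (there a) (there b) e)
    where
    fx∉ : f x ∉ map f xs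
    fx∉ m with ∈-map⁻ f m
    ... | a , q , e with inj (here refl) (there q) e
    ... | refl = x∉ q

  ∈-concatMap⁺ : (g : A → List B) {a : A} {b : B} (xs : List A) → a ∈ xs → b ∈ g a → b ∈ concatMap g xs
  ∈-concatMap⁺ g (x ∷ xs) (here refl) mb = ∈-++⁺ˡ mb
  ∈-concatMap⁺ g (x ∷ xs) (there m)   mb = ∈-++⁺ʳ (g x) (∈-concatMap⁺ g xs m mb)

  ∈-concatMap⁻ : (g : A → List B) {b : B} (xs : List A) → b ∈ concatMap g xs → ∃[ a ] (a ∈ xs × b ∈ g a)
  ∈-concatMap⁻ g (x ∷ xs) m with ∈-++⁻ (g x) m
  ... | inj₁ q = x , here refl , q
  ... | inj₂ q with ∈-concatMap⁻ g xs q
  ... | a , ma , mb = a , there ma , mb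

  distinct-concatMap : (g : A → List B) (key : B → A) (xs : List A) → Distinct xs →
    (∀ {a} → a ∈ xs → Distinct (g a)) → (∀ {a b} → a ∈ xs → b ∈ g a → key b ≡ a) →
    Distinct (concatMap g xs)
  distinct-concatMap g key []       d        dg k = []
  distinct-concatMap g key (x ∷ xs) (x∉ ∷ d) dg k =
    distinct-++ (g x) _ (dg (here refl)) (distinct-concatMap g key xs d (dg ∘ there) (k ∘ there)) disjoint
    where
    disjoint : ∀ {b} → b ∈ g x → b ∉ concatMap g xs
    disjoint m₁ m₂ with ∈-concatMap⁻ g xs m₂
    ... | a , ma , mb with trans (sym (k (here refl) m₁)) (k (there ma) mb)
    ... | refl = x∉ ma

T⇒≡true : ∀ {b} → T b → b ≡ true
T⇒≡true {true} _ = refl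

¬T⇒≡false : ∀ {b} → ¬ T b → b ≡ false
¬T⇒≡false {true}  ¬t = ⊥-elim (¬t tt)
¬T⇒≡false {false} _  = refl

≡true⇒T : ∀ {b} → b ≡ true → T b
≡true⇒T refl = tt

true≢false : true ≢ false
true≢false ()

module _ {a b : ℕ} where

  ≡ᵇ-true : a ≡ b → (a ≡ᵇ b) ≡ true
  ≡ᵇ-true e = T⇒≡true (≡⇒≡ᵇ a b e)

  ≡ᵇ-false : a ≢ b → (a ≡ᵇ b) ≡ false
  ≡ᵇ-false ne = ¬T⇒≡false (λ t → ne (≡ᵇ⇒≡ a b t))

  ≡ᵇ-true⁻ : (a ≡ᵇ b) ≡ true → a ≡ b
  ≡ᵇ-true⁻ e = ≡ᵇ⇒≡ a b (≡true⇒T e)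

  ≡ᵇ-false⁻ : (a ≡ᵇ b) ≡ false → a ≢ b
  ≡ᵇ-false⁻ e p with trans (sym e) (≡ᵇ-true p)
  ... | ()

  <ᵇ-true : a < b → (a <ᵇ b) ≡ true
  <ᵇ-true p = T⇒≡true (<⇒<ᵇ p)

  <ᵇ-false : ¬ (a < b) → (a <ᵇ b) ≡ false
  <ᵇ-false ¬p = ¬T⇒≡false (λ t → ¬p (<ᵇ⇒< a b t))

  <ᵇ-true⁻ : (a <ᵇ b) ≡ true → a < b
  <ᵇ-true⁻ e = <ᵇ⇒< a b (≡true⇒T e)

  ≤ᵇ-true : a ≤ b → (a ≤ᵇ b) ≡ true
  ≤ᵇ-true p = T⇒≡true (≤⇒≤ᵇ p)

  ≤ᵇ-false : ¬ (a ≤ b) → (a ≤ᵇ b) ≡ false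
  ≤ᵇ-false ¬p = ¬T⇒≡false (λ t → ¬p (≤ᵇ⇒≤ a b t))

∧-true⁻ : ∀ {u v} → (u ∧ v) ≡ true → u ≡ true × v ≡ true
∧-true⁻ {true} {true} _ = refl , refl

∧-true : ∀ {u v} → u ≡ true → v ≡ true → (u ∧ v) ≡ true
∧-true refl refl = refl

∨-true⁻ : ∀ {u v} → (u ∨ v) ≡ true → u ≡ true ⊎ v ≡ true
∨-true⁻ {true}  _ = inj₁ refl
∨-true⁻ {false} e = inj₂ e

∨-false⁻ : ∀ {u v} → (u ∨ v) ≡ false → u ≡ false × v ≡ false
∨-false⁻ {false} {false} _ = refl , refl

not-false : ∀ {b} → b ≡ false → not b ≡ true
not-false refl = refl

not-true⁻ : ∀ {b} → not b ≡ true → b ≡ false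
not-true⁻ {false} _ = refl

if-true : {A : Set} {b : Bool} {u v : A} → b ≡ true → (if b then u else v) ≡ u
if-true refl = refl

if-false : {A : Set} {b : Bool} {u v : A} → b ≡ false → (if b then u else v) ≡ v
if-false refl = refl

module _ {A : Set} (p : A → Bool) where

  any-true⁻ : (xs : List A) → any p xs ≡ true → ∃[ a ] (a ∈ xs × p a ≡ true)
  any-true⁻ (x ∷ xs) e with p x in eq
  ... | true  = x , here refl , eq
  ... | false with any-true⁻ xs e
  ...   | a , m , e′ = a , there m , e′

  any-true : (xs : List A) {a : A} → a ∈ xs → p a ≡ true → any p xs ≡ true
  any-true (x ∷ xs) (here refl) e rewrite e = refl
  any-true (x ∷ xs) (there m)   e with p x
  ... | true  = refl
  ... | false = any-true xs m e

any-cong : {A : Set} (p q : A → Bool) (xs : List A) → (∀ {a} → a ∈ xs → p a ≡ q a) → any p xs ≡ any q xs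
any-cong p q []       h = refl
any-cong p q (x ∷ xs) h = cong₂ _∨_ (h (here refl)) (any-cong p q xs (h ∘ there))

all-applyUpTo-cong : ∀ n (f g : ℕ → ℕ) (P Q : ℕ → Bool) → (∀ k → k < n → P (f k) ≡ Q (g k)) →
  all P (applyUpTo f n) ≡ all Q (applyUpTo g n)
all-applyUpTo-cong zero    f g P Q h = refl
all-applyUpTo-cong (suc n) f g P Q h =
  cong₂ _∧_ (h 0 (s≤s z≤n)) (all-applyUpTo-cong n (f ∘ suc) (g ∘ suc) P Q (λ k k< → h (suc k) (s≤s k<)))

InRange : ℕ → ℕ → Set
InRange n y = 1 ≤ y × y ≤ n

InRange-cong : ∀ {n m y} → n ≡ m → InRange n y → InRange m y
InRange-cong refl r = r

InRange-suc : ∀ {n y} → InRange n y → InRange (suc n) y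
InRange-suc (y≥1 , y≤n) = y≥1 , m≤n⇒m≤1+n y≤n

InRange-top : ∀ n → InRange (suc n) (suc n)
InRange-top n = s≤s z≤n , ≤-refl

∈-range⁻ : ∀ n {a} → a ∈ range n → InRange n a
∈-range⁻ (suc n) m with ∈-++⁻ (range n) m
... | inj₁ q         = InRange-suc (∈-range⁻ n q)
... | inj₂ (here refl) = InRange-top n

∈-range⁺ : ∀ n {a} → InRange n a → a ∈ range n
∈-range⁺ zero    (a≥1 , a≤0) = ⊥-elim (<⇒≱ a≥1 a≤0)
∈-range⁺ (suc n) (a≥1 , a≤n) with m≤n⇒m<n∨m≡n a≤n
... | inj₁ (s≤s q) = ∈-++⁺ˡ (∈-range⁺ n (a≥1 , q))
... | inj₂ refl    = ∈-++⁺ʳ (range n) (here refl)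

distinct-range : ∀ n → Distinct (range n)
distinct-range zero    = []
distinct-range (suc n) = distinct-++ (range n) _ (distinct-range n) ((λ ()) ∷ [])
  λ { m (here refl) → <⇒≱ (s≤s ≤-refl) (proj₂ (∈-range⁻ n m)) }

length-range : ∀ n → length (range n) ≡ n
length-range zero    = refl
length-range (suc n) = trans (length-++ (range n)) (trans (+-comm (length (range n)) 1) (cong suc (length-range n)))

∑-range-suc : (f : ℕ → ℕ) (n : ℕ) → ∑ f (range (suc n)) ≡ ∑ f (range n) + f (suc n)
∑-range-suc f n = trans (∑-++ f (range n) _) (cong (∑ f (range n) +_) (+-identityʳ (f (suc n))))

∈⇒app : ∀ {a} (w : List ℕ) → a ∈ w → ∃[ y ] (InRange (length w) y × app w y ≡ a)
∈⇒app (b ∷ bs) (here refl) = 1 , (s≤s z≤n , s≤s z≤n) , refl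
∈⇒app (b ∷ bs) (there m) with ∈⇒app bs m
... | suc y , (_ , y≤) , e = suc (suc y) , (s≤s z≤n , s≤s y≤) , e

app-∈ : ∀ (w : List ℕ) y → InRange (length w) y → app w y ∈ w
app-∈ (b ∷ bs) (suc zero)    r           = here refl
app-∈ (b ∷ bs) (suc (suc y)) (_ , s≤s r) = there (app-∈ bs (suc y) (s≤s z≤n , r))

InjectiveOn : ℕ → (ℕ → ℕ) → Set
InjectiveOn n f = ∀ y z → InRange n y → InRange n z → f y ≡ f z → y ≡ z

distinct⇒injective : ∀ (w : List ℕ) → Distinct w → InjectiveOn (length w) (app w)
distinct⇒injective (b ∷ bs) d        (suc zero)    (suc zero)    _           _           e = refl
distinct⇒injective (b ∷ bs) (b∉ ∷ d) (suc zero)    (suc (suc z)) _           (_ , s≤s rz) e =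
  ⊥-elim (b∉ (subst (_∈ bs) (sym e) (app-∈ bs (suc z) (s≤s z≤n , rz))))
distinct⇒injective (b ∷ bs) (b∉ ∷ d) (suc (suc y)) (suc zero)    (_ , s≤s ry) _          e =
  ⊥-elim (b∉ (subst (_∈ bs) e (app-∈ bs (suc y) (s≤s z≤n , ry))))
distinct⇒injective (b ∷ bs) (b∉ ∷ d) (suc (suc y)) (suc (suc z)) (_ , s≤s ry) (_ , s≤s rz) e =
  cong suc (distinct⇒injective bs d (suc y) (suc z) (s≤s z≤n , ry) (s≤s z≤n , rz) e)

injective⇒distinct : ∀ (w : List ℕ) → InjectiveOn (length w) (app w) → Distinct w
injective⇒distinct []       inj = []
injective⇒distinct (b ∷ bs) inj = b∉ ∷ injective⇒distinct bs inj′
  where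
  b∉ : b ∉ bs
  b∉ m with ∈⇒app bs m
  ... | suc y , (_ , y≤) , e with inj 1 (suc (suc y)) (s≤s z≤n , s≤s z≤n) (s≤s z≤n , s≤s y≤) (sym e)
  ... | ()
  inj′ : InjectiveOn (length bs) (app bs)
  inj′ (suc y) (suc z) (_ , ry) (_ , rz) e =
    suc-injective (inj (suc (suc y)) (suc (suc z)) (s≤s z≤n , s≤s ry) (s≤s z≤n , s≤s rz) e)

app-ext : ∀ (xs ys : List ℕ) → length xs ≡ length ys → (∀ y → InRange (length xs) y → app xs y ≡ app ys y) → xs ≡ ys
app-ext []       []       _ _ = refl
app-ext (x ∷ xs) (y ∷ ys) l h = cong₂ _∷_ (h 1 (s≤s z≤n , s≤s z≤n))
  (app-ext xs ys (suc-injective l) λ { (suc z) (_ , r) → h (suc (suc z)) (s≤s z≤n , s≤s r) })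

elem⇒∈ : ∀ a (bs : List ℕ) → elem a bs ≡ true → a ∈ bs
elem⇒∈ a (b ∷ bs) e with a ≡ᵇ b in eq
... | true  = here (≡ᵇ-true⁻ eq)
... | false = there (elem⇒∈ a bs e)

∈⇒elem : ∀ a (bs : List ℕ) → a ∈ bs → elem a bs ≡ true
∈⇒elem a (b ∷ bs) (here refl) rewrite ≡ᵇ-true {a} refl = refl
∈⇒elem a (b ∷ bs) (there m) with a ≡ᵇ b
... | true  = refl
... | false = ∈⇒elem a bs m

distinct⇒Distinct : ∀ (w : List ℕ) → distinct w ≡ true → Distinct w
distinct⇒Distinct []       e = []
distinct⇒Distinct (b ∷ bs) e with elem b bs in eq
... | false = (λ m → true≢false (trans (sym (∈⇒elem b bs m)) eq)) ∷ distinct⇒Distinct bs e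

Distinct⇒distinct : ∀ (w : List ℕ) → Distinct w → distinct w ≡ true
Distinct⇒distinct []       d        = refl
Distinct⇒distinct (b ∷ bs) (b∉ ∷ d) with elem b bs in eq
... | true  = ⊥-elim (b∉ (elem⇒∈ b bs eq))
... | false = Distinct⇒distinct bs d

∈-words⁻ : ∀ n m {w} → w ∈ words n m → length w ≡ m × (∀ {a} → a ∈ w → a ∈ range n)
∈-words⁻ n zero    (here refl) = refl , λ ()
∈-words⁻ n (suc m) mw with ∈-concatMap⁻ (λ a → map (a ∷_) (words n m)) (range n) mw
... | a , ma , mb with ∈-map⁻ (a ∷_) mb
... | v , mv , refl with ∈-words⁻ n m mv
... | l , letters = cong suc l , λ { (here refl) → ma ; (there q) → letters q }

∈-words⁺ : ∀ n m (w : List ℕ) → length w ≡ m → (∀ {a} → a ∈ w → a ∈ range n) → w ∈ words n m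
∈-words⁺ n zero    []      l letters = here refl
∈-words⁺ n (suc m) (a ∷ w) l letters =
  ∈-concatMap⁺ (λ a → map (a ∷_) (words n m)) (range n) (letters (here refl))
    (∈-map⁺ (a ∷_) (∈-words⁺ n m w (suc-injective l) (letters ∘ there)))

distinct-words : ∀ n m → Distinct (words n m)
distinct-words n zero    = (λ ()) ∷ []
distinct-words n (suc m) = distinct-concatMap (λ a → map (a ∷_) (words n m)) head (range n) (distinct-range n)
  (λ _ → distinct-map (_ ∷_) (words n m) (distinct-words n m) (λ _ _ → ∷-injectiveʳ))
  (λ _ mb → head-∈map∷ mb)
  where
  head : List ℕ → ℕ
  head []      = 0
  head (x ∷ _) = x
  head-∈map∷ : ∀ {a b} → b ∈ map (a ∷_) (words n m) → head b ≡ a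
  head-∈map∷ mb with ∈-map⁻ (_ ∷_) mb
  ... | v , _ , refl = refl

distinct-perms : ∀ n → Distinct (perms n)
distinct-perms n = distinct-filterᵇ distinct (words n n) (distinct-words n n)

record IsPerm (n : ℕ) (w : List ℕ) : Set where
  field
    len : length w ≡ n
    rng : ∀ y → InRange n y → InRange n (app w y)
    inj : InjectiveOn n (app w)
open IsPerm public

∈perms⇒IsPerm : ∀ n {w} → w ∈ perms n → IsPerm n w
∈perms⇒IsPerm n {w} m with ∈-filterᵇ⁻ distinct (words n n) m
... | mw , d with ∈-words⁻ n n mw
... | l , letters = record
  { len = l
  ; rng = λ y r → ∈-range⁻ n (letters (app-∈ w y (InRange-cong (sym l) r)))
  ; inj = λ y z ry rz → distinct⇒injective w (distinct⇒Distinct w d) y z (InRange-cong (sym l) ry) (InRange-cong (sym l) rz)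
  }

IsPerm⇒distinct : ∀ n {w} → IsPerm n w → Distinct w
IsPerm⇒distinct n {w} p = injective⇒distinct w (subst (λ k → InjectiveOn k (app w)) (sym (len p)) (inj p))

IsPerm⇒letters : ∀ n {w} → IsPerm n w → ∀ {a} → a ∈ w → a ∈ range n
IsPerm⇒letters n {w} p m with ∈⇒app w m
... | y , r , refl = ∈-range⁺ n (rng p y (InRange-cong (len p) r))

IsPerm⇒∈perms : ∀ n {w} → IsPerm n w → w ∈ perms n
IsPerm⇒∈perms n {w} p = ∈-filterᵇ⁺ distinct (words n n)
  (∈-words⁺ n n w (len p) (IsPerm⇒letters n p))
  (Distinct⇒distinct w (IsPerm⇒distinct n p))

-- Otherwise a ∷ w would be a duplicate-free list of n + 1 elements of [1, n].
IsPerm-surjective : ∀ n {w} → IsPerm n w → ∀ a → InRange n a → ∃[ y ] (InRange n y × app w y ≡ a)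
IsPerm-surjective n {w} p a r with a ∈? w
... | yes m with ∈⇒app w m
...   | y , ry , e = y , InRange-cong (len p) ry , e
IsPerm-surjective n {w} p a r | no a∉ = ⊥-elim (<⇒≱ (s≤s (≤-reflexive (sym (len p)))) tooLong)
  where
  tooLong : suc (length w) ≤ n
  tooLong = subst (suc (length w) ≤_) (length-range n)
    (length-mono-⊆ (a ∷ w) (range n) (a∉ ∷ IsPerm⇒distinct n p)
      λ { (here refl) → ∈-range⁺ n r ; (there m) → IsPerm⇒letters n p m })

-- Inserting the letter n + 1

setAt : List ℕ → ℕ → ℕ → List ℕ
setAt []       x             v = []
setAt (b ∷ bs) zero          v = b ∷ bs
setAt (b ∷ bs) (suc zero)    v = v ∷ bs
setAt (b ∷ bs) (suc (suc x)) v = b ∷ setAt bs (suc x) v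

length-setAt : ∀ σ x v → length (setAt σ x v) ≡ length σ
length-setAt []       x             v = refl
length-setAt (b ∷ bs) zero          v = refl
length-setAt (b ∷ bs) (suc zero)    v = refl
length-setAt (b ∷ bs) (suc (suc x)) v = cong suc (length-setAt bs (suc x) v)

app-setAt-same : ∀ σ x v → InRange (length σ) x → app (setAt σ x v) x ≡ v
app-setAt-same (b ∷ bs) (suc zero)    v r           = refl
app-setAt-same (b ∷ bs) (suc (suc x)) v (_ , s≤s r) = app-setAt-same bs (suc x) v (s≤s z≤n , r)

app-setAt-other : ∀ σ x v y → 1 ≤ x → y ≢ x → app (setAt σ x v) y ≡ app σ y
app-setAt-other []       x             v y             _ _   = refl
app-setAt-other (b ∷ bs) (suc zero)    v zero          _ _   = refl
app-setAt-other (b ∷ bs) (suc zero)    v (suc zero)    _ y≢x = ⊥-elim (y≢x refl)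
app-setAt-other (b ∷ bs) (suc zero)    v (suc (suc y)) _ _   = refl
app-setAt-other (b ∷ bs) (suc (suc x)) v zero          _ _   = refl
app-setAt-other (b ∷ bs) (suc (suc x)) v (suc zero)    _ _   = refl
app-setAt-other (b ∷ bs) (suc (suc x)) v (suc (suc y)) _ y≢x =
  app-setAt-other bs (suc x) v (suc y) (s≤s z≤n) (y≢x ∘ cong suc)

app-++ˡ : ∀ xs ys y → InRange (length xs) y → app (xs ++ ys) y ≡ app xs y
app-++ˡ (b ∷ bs) ys (suc zero)    r           = refl
app-++ˡ (b ∷ bs) ys (suc (suc y)) (_ , s≤s r) = app-++ˡ bs ys (suc y) (s≤s z≤n , r)

app-++-last : ∀ xs v → app (xs ++ v ∷ []) (suc (length xs)) ≡ v
app-++-last []       v = refl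
app-++-last (b ∷ bs) v = app-++-last bs v

length-++-last : ∀ (xs : List ℕ) v → length (xs ++ v ∷ []) ≡ suc (length xs)
length-++-last []       v = refl
length-++-last (b ∷ bs) v = cong suc (length-++-last bs v)

length-take-≤ : ∀ n (τ : List ℕ) → n ≤ length τ → length (take n τ) ≡ n
length-take-≤ zero    τ        _       = refl
length-take-≤ (suc n) (b ∷ bs) (s≤s p) = cong suc (length-take-≤ n bs p)

app-take : ∀ n (τ : List ℕ) y → InRange n y → app (take n τ) y ≡ app τ y
app-take zero    τ        y             (y≥1 , y≤0) = ⊥-elim (<⇒≱ y≥1 y≤0)
app-take (suc n) []       y             r           = refl
app-take (suc n) (b ∷ bs) (suc zero)    r           = refl
app-take (suc n) (b ∷ bs) (suc (suc y)) (_ , s≤s r) = app-take n bs (suc y) (s≤s z≤n , r)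

indexOf : ℕ → List ℕ → ℕ
indexOf v []       = 0
indexOf v (b ∷ bs) = if b ≡ᵇ v then 1 else suc (indexOf v bs)

indexOf-spec : ∀ v (w : List ℕ) → v ∈ w → InRange (length w) (indexOf v w) × app w (indexOf v w) ≡ v
indexOf-spec v (b ∷ bs) m with b ≡ᵇ v in eq
... | true = (s≤s z≤n , s≤s z≤n) , ≡ᵇ-true⁻ eq
... | false with m
...   | here refl = ⊥-elim (≡ᵇ-false⁻ {b} {v} eq refl)
...   | there m′ with indexOf-spec v bs m′
...     | (r₁ , r₂) , e with indexOf v bs | r₁
...       | suc k | _ = (s≤s z≤n , s≤s r₂) , e

-- insertMax n σ x inserts n + 1 into the cycle notation of σ ∈ 𝔖ₙ right after x,
-- or as a new fixed point when x = 0.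
insertMax : ℕ → List ℕ → ℕ → List ℕ
insertMax n σ zero    = σ ++ (suc n ∷ [])
insertMax n σ (suc x) = setAt σ (suc x) (suc n) ++ (app σ (suc x) ∷ [])

removeMax : ℕ → List ℕ → List ℕ × ℕ
removeMax n τ =
  if app τ (suc n) ≡ᵇ suc n
  then (take n τ , 0)
  else (setAt (take n τ) (indexOf (suc n) τ) (app τ (suc n)) , indexOf (suc n) τ)

module _ {n : ℕ} {σ : List ℕ} (p : IsPerm n σ) where

  length-insertMax : ∀ x → length (insertMax n σ x) ≡ suc n
  length-insertMax zero    = trans (length-++-last σ _) (cong suc (len p))
  length-insertMax (suc x) = trans (length-++-last (setAt σ (suc x) (suc n)) _) (cong suc (trans (length-setAt σ _ _) (len p)))

  insertMax-other : ∀ x y → InRange n y → y ≢ x → app (insertMax n σ x) y ≡ app σ y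
  insertMax-other zero    y r y≢x = app-++ˡ σ _ y (InRange-cong (sym (len p)) r)
  insertMax-other (suc x) y r y≢x =
    trans (app-++ˡ (setAt σ (suc x) (suc n)) _ y (InRange-cong (sym (trans (length-setAt σ _ _) (len p))) r))
          (app-setAt-other σ (suc x) (suc n) y (s≤s z≤n) y≢x)

  insertMax-at : ∀ x → InRange n x → app (insertMax n σ x) x ≡ suc n
  insertMax-at (suc x) r =
    trans (app-++ˡ (setAt σ (suc x) (suc n)) _ (suc x) (InRange-cong (sym (trans (length-setAt σ _ _) (len p))) r))
          (app-setAt-same σ (suc x) (suc n) (InRange-cong (sym (len p)) r))

  insertMax-top-fixed : app (insertMax n σ 0) (suc n) ≡ suc n
  insertMax-top-fixed = subst (λ k → app (σ ++ suc n ∷ []) (suc k) ≡ suc n) (len p) (app-++-last σ (suc n))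

  insertMax-top : ∀ x → 1 ≤ x → app (insertMax n σ x) (suc n) ≡ app σ x
  insertMax-top (suc x) _ =
    subst (λ k → app (setAt σ (suc x) (suc n) ++ app σ (suc x) ∷ []) (suc k) ≡ app σ (suc x))
          (trans (length-setAt σ _ _) (len p)) (app-++-last (setAt σ (suc x) (suc n)) _)

  app-<-suc : ∀ y → InRange n y → app σ y < suc n
  app-<-suc y r = s≤s (proj₂ (rng p y r))

  module _ (x : ℕ) (x≤n : x ≤ n) where

    private
      τ = insertMax n σ x

    data Position (y : ℕ) : Set where
      top   : y ≡ suc n → Position y
      at    : y ≡ x → 1 ≤ x → Position y
      other : InRange n y → y ≢ x → Position y

    position : ∀ y → InRange (suc n) y → Position y
    position y (y≥1 , y≤) with m≤n⇒m<n∨m≡n y≤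
    ... | inj₂ e = top e
    ... | inj₁ (s≤s y≤n) with y ≟ x
    ...   | yes e = at e (subst (1 ≤_) e y≥1)
    ...   | no y≢x = other (y≥1 , y≤n) y≢x

    app-insertMax-top : app τ (suc n) ≡ suc n ⊎ (1 ≤ x × app τ (suc n) ≡ app σ x)
    app-insertMax-top with x ≟ 0
    ... | yes refl = inj₁ insertMax-top-fixed
    ... | no x≢0   = inj₂ (n≢0⇒n>0 x≢0 , insertMax-top x (n≢0⇒n>0 x≢0))

    insertMax-rng : ∀ y → InRange (suc n) y → InRange (suc n) (app τ y)
    insertMax-rng y r with position y r
    ... | top refl with app-insertMax-top
    ...   | inj₁ e        = subst (InRange (suc n)) (sym e) (InRange-top n)
    ...   | inj₂ (x≥1 , e) = subst (InRange (suc n)) (sym e) (InRange-suc (rng p x (x≥1 , x≤n)))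
    insertMax-rng y r | at refl y≥1 = subst (InRange (suc n)) (sym (insertMax-at x (y≥1 , x≤n))) (InRange-top n)
    insertMax-rng y r | other r′ y≢x = subst (InRange (suc n)) (sym (insertMax-other x y r′ y≢x)) (InRange-suc (rng p y r′))

    private
      top≢at : 1 ≤ x → app τ (suc n) ≢ app τ x
      top≢at x≥1 e = <⇒≢ (app-<-suc x (x≥1 , x≤n))
        (trans (sym (insertMax-top x x≥1)) (trans e (insertMax-at x (x≥1 , x≤n))))

      other≢at : ∀ z → InRange n z → z ≢ x → 1 ≤ x → app τ z ≢ app τ x
      other≢at z r z≢x x≥1 e = <⇒≢ (app-<-suc z r)
        (trans (sym (insertMax-other x z r z≢x)) (trans e (insertMax-at x (x≥1 , x≤n))))

      other≢top : ∀ z → InRange n z → z ≢ x → app τ z ≢ app τ (suc n)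
      other≢top z r z≢x e with app-insertMax-top
      ... | inj₁ e′         = <⇒≢ (app-<-suc z r) (trans (sym (insertMax-other x z r z≢x)) (trans e e′))
      ... | inj₂ (x≥1 , e′) =
        z≢x (inj p z x r (x≥1 , x≤n) (trans (sym (insertMax-other x z r z≢x)) (trans e e′)))

    insertMax-inj : InjectiveOn (suc n) (app τ)
    insertMax-inj y z ry rz e with position y ry | position z rz
    ... | top refl    | top refl    = refl
    ... | at refl _   | at refl _   = refl
    ... | other r₁ n₁ | other r₂ n₂ =
      inj p y z r₁ r₂ (trans (sym (insertMax-other x y r₁ n₁)) (trans e (insertMax-other x z r₂ n₂)))
    ... | top refl    | at refl x≥1 = ⊥-elim (top≢at x≥1 e)
    ... | at refl x≥1 | top refl    = ⊥-elim (top≢at x≥1 (sym e))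
    ... | other r y≢x | at refl x≥1 = ⊥-elim (other≢at y r y≢x x≥1 e)
    ... | at refl x≥1 | other r z≢x = ⊥-elim (other≢at z r z≢x x≥1 (sym e))
    ... | other r y≢x | top refl    = ⊥-elim (other≢top y r y≢x e)
    ... | top refl    | other r z≢x = ⊥-elim (other≢top z r z≢x (sym e))

    insertMax-isPerm : IsPerm (suc n) τ
    insertMax-isPerm = record { len = length-insertMax x ; rng = insertMax-rng ; inj = insertMax-inj }

-- Insertion is a bijection from 𝔖ₙ × {0, …, n} onto 𝔖ₙ₊₁

≤-pred-≢ : ∀ {a n} → a ≤ suc n → a ≢ suc n → a ≤ n
≤-pred-≢ a≤ a≢ = ≤-pred (≤∧≢⇒< a≤ a≢)

module _ {n : ℕ} {τ : List ℕ} (n≤ : n ≤ length τ) where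

  length-take : length (take n τ) ≡ n
  length-take = length-take-≤ n τ n≤

  length-setAt-take : ∀ x v → length (setAt (take n τ) x v) ≡ n
  length-setAt-take x v = trans (length-setAt (take n τ) x v) length-take

module _ {n : ℕ} {σ : List ℕ} (p : IsPerm n σ) where

  private
    n≤length : ∀ x → n ≤ length (insertMax n σ x)
    n≤length x = subst (n ≤_) (sym (length-insertMax p x)) (n≤1+n n)

  take-insertMax : ∀ x y → InRange n y → y ≢ x → app (take n (insertMax n σ x)) y ≡ app σ y
  take-insertMax x y r y≢x = trans (app-take n _ y r) (insertMax-other p x y r y≢x)

  removeMax-insertMax-fixed : removeMax n (insertMax n σ 0) ≡ (σ , 0)
  removeMax-insertMax-fixed = trans (if-true (≡ᵇ-true (insertMax-top-fixed p)))
    (cong (_, 0) (app-ext _ σ (trans (length-take (n≤length 0)) (sym (len p)))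
      λ y r → let r′ = InRange-cong (length-take (n≤length 0)) r in
        take-insertMax 0 y r′ (λ e → <⇒≢ (proj₁ r′) (sym e))))

  module _ (x : ℕ) (x≥1 : 1 ≤ x) (x≤n : x ≤ n) where

    private
      τ = insertMax n σ x
      rx : InRange n x
      rx = x≥1 , x≤n

    indexOf-insertMax : indexOf (suc n) τ ≡ x
    indexOf-insertMax = insertMax-inj p x x≤n _ x (InRange-cong (length-insertMax p x) r) (InRange-suc rx)
                          (trans e (sym (insertMax-at p x rx)))
      where
      top∈τ : suc n ∈ τ
      top∈τ = subst (_∈ τ) (insertMax-at p x rx) (app-∈ τ x (InRange-cong (sym (length-insertMax p x)) (InRange-suc rx)))
      r = proj₁ (indexOf-spec (suc n) τ top∈τ)
      e = proj₂ (indexOf-spec (suc n) τ top∈τ)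

    setAt-take-insertMax : setAt (take n τ) x (app τ (suc n)) ≡ σ
    setAt-take-insertMax = app-ext _ σ (trans (length-setAt-take (n≤length x) x _) (sym (len p))) λ y r →
      restore y (InRange-cong (length-setAt-take (n≤length x) x _) r)
      where
      restore : ∀ y → InRange n y → app (setAt (take n τ) x (app τ (suc n))) y ≡ app σ y
      restore y r with y ≟ x
      ... | yes refl = trans (app-setAt-same (take n τ) x _ (InRange-cong (sym (length-take (n≤length x))) r))
                             (insertMax-top p x x≥1)
      ... | no y≢x   = trans (app-setAt-other (take n τ) x _ y x≥1 y≢x) (take-insertMax x y r y≢x)

    removeMax-insertMax-moved : removeMax n τ ≡ (σ , x)
    removeMax-insertMax-moved = trans (if-false (≡ᵇ-false top-moved))
      (cong₂ _,_ (trans (cong (λ k → setAt (take n τ) k (app τ (suc n))) indexOf-insertMax) setAt-take-insertMax)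
                 indexOf-insertMax)
      where
      top-moved : app τ (suc n) ≢ suc n
      top-moved e = <⇒≢ (app-<-suc p x rx) (trans (sym (insertMax-top p x x≥1)) e)

  removeMax-insertMax : ∀ x → x ≤ n → removeMax n (insertMax n σ x) ≡ (σ , x)
  removeMax-insertMax zero    _   = removeMax-insertMax-fixed
  removeMax-insertMax (suc x) x≤n = removeMax-insertMax-moved (suc x) (s≤s z≤n) x≤n

module _ {n : ℕ} {τ : List ℕ} (q : IsPerm (suc n) τ) where

  private
    n≤ : n ≤ length τ
    n≤ = subst (n ≤_) (sym (len q)) (n≤1+n n)

    τ-inj : ∀ y z → InRange n y → InRange n z → app τ y ≡ app τ z → y ≡ z
    τ-inj y z ry rz = inj q y z (InRange-suc ry) (InRange-suc rz)

  insertMax-onto-fixed : app τ (suc n) ≡ suc n → IsPerm n (take n τ) × insertMax n (take n τ) 0 ≡ τ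
  insertMax-onto-fixed fixed = σ-perm , app-ext _ τ (trans (length-insertMax σ-perm 0) (sym (len q))) agree
    where
    σ = take n τ
    below-top : ∀ y → InRange n y → app τ y ≢ suc n
    below-top y r e = <⇒≢ (s≤s (proj₂ r)) (inj q y (suc n) (InRange-suc r) (InRange-top n) (trans e (sym fixed)))
    σ-perm : IsPerm n σ
    σ-perm = record
      { len = length-take n≤
      ; rng = λ y r → let (a , b) = rng q y (InRange-suc r) in
                subst (InRange n) (sym (app-take n τ y r)) (a , ≤-pred-≢ b (below-top y r))
      ; inj = λ y z ry rz e → τ-inj y z ry rz (trans (sym (app-take n τ y ry)) (trans e (app-take n τ z rz)))
      }
    agree : ∀ y → InRange (length (insertMax n σ 0)) y → app (insertMax n σ 0) y ≡ app τ y
    agree y r with m≤n⇒m<n∨m≡n (proj₂ (InRange-cong (length-insertMax σ-perm 0) r))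
    ... | inj₂ refl   = trans (insertMax-top-fixed σ-perm) (sym fixed)
    ... | inj₁ (s≤s b) = trans (insertMax-other σ-perm 0 y (proj₁ r , b) (λ e → <⇒≢ (proj₁ r) (sym e)))
                               (app-take n τ y (proj₁ r , b))

  module _ (moved : app τ (suc n) ≢ suc n) where

    private
      v = app τ (suc n)
      top∈τ : suc n ∈ τ
      top∈τ with IsPerm-surjective (suc n) q (suc n) (InRange-top n)
      ... | y , r , e = subst (_∈ τ) e (app-∈ τ y (InRange-cong (sym (len q)) r))
      P = indexOf (suc n) τ
      τP : app τ P ≡ suc n
      τP = proj₂ (indexOf-spec (suc n) τ top∈τ)
      rP : InRange (suc n) P
      rP = InRange-cong (len q) (proj₁ (indexOf-spec (suc n) τ top∈τ))

    indexOf≤n : P ≤ n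
    indexOf≤n = ≤-pred-≢ (proj₂ rP) λ e → moved (subst (λ k → app τ k ≡ suc n) e τP)

    private
      σ = setAt (take n τ) P v
      σP : app σ P ≡ v
      σP = app-setAt-same (take n τ) P v (InRange-cong (sym (length-take n≤)) (proj₁ rP , indexOf≤n))
      σ-other : ∀ y → InRange n y → y ≢ P → app σ y ≡ app τ y
      σ-other y r y≢P = trans (app-setAt-other (take n τ) P v y (proj₁ rP) y≢P) (app-take n τ y r)
      top-unique : ∀ y → InRange n y → y ≢ P → app τ y ≢ suc n
      top-unique y r y≢P e = y≢P (inj q y P (InRange-suc r) rP (trans e (sym τP)))
      v≢τ : ∀ y → InRange n y → app τ y ≢ v
      v≢τ y r e = <⇒≢ (s≤s (proj₂ r)) (inj q y (suc n) (InRange-suc r) (InRange-top n) e)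

      σ-rng : ∀ y → InRange n y → InRange n (app σ y)
      σ-rng y r with y ≟ P
      ... | yes refl = subst (InRange n) (sym σP) (let (a , b) = rng q (suc n) (InRange-top n) in a , ≤-pred-≢ b moved)
      ... | no y≢P   = subst (InRange n) (sym (σ-other y r y≢P))
                         (let (a , b) = rng q y (InRange-suc r) in a , ≤-pred-≢ b (top-unique y r y≢P))

      σ-inj : InjectiveOn n (app σ)
      σ-inj y z ry rz e with y ≟ P | z ≟ P
      ... | yes refl | yes refl = refl
      ... | yes refl | no z≢P   = ⊥-elim (v≢τ z rz (trans (sym (σ-other z rz z≢P)) (trans (sym e) σP)))
      ... | no y≢P   | yes refl = ⊥-elim (v≢τ y ry (trans (sym (σ-other y ry y≢P)) (trans e σP)))
      ... | no y≢P   | no z≢P   = τ-inj y z ry rz (trans (sym (σ-other y ry y≢P)) (trans e (σ-other z rz z≢P)))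

    insertMax-onto-moved : IsPerm n σ × insertMax n σ P ≡ τ
    insertMax-onto-moved = σ-perm , app-ext _ τ (trans (length-insertMax σ-perm P) (sym (len q))) agree
      where
      σ-perm : IsPerm n σ
      σ-perm = record { len = length-setAt-take n≤ P v ; rng = σ-rng ; inj = σ-inj }
      agree : ∀ y → InRange (length (insertMax n σ P)) y → app (insertMax n σ P) y ≡ app τ y
      agree y r with m≤n⇒m<n∨m≡n (proj₂ (InRange-cong (length-insertMax σ-perm P) r))
      ... | inj₂ refl    = trans (insertMax-top σ-perm P (proj₁ rP)) σP
      ... | inj₁ (s≤s b) with y ≟ P
      ...   | yes refl = trans (insertMax-at σ-perm P (proj₁ rP , indexOf≤n)) (sym τP)
      ...   | no y≢P   = trans (insertMax-other σ-perm P y (proj₁ r , b) y≢P) (σ-other y (proj₁ r , b) y≢P)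

  insertMax-onto : ∃[ σ ] ∃[ x ] (IsPerm n σ × x ≤ n × insertMax n σ x ≡ τ)
  insertMax-onto with app τ (suc n) ≟ suc n
  ... | yes fixed = let (σ-perm , e) = insertMax-onto-fixed fixed in _ , 0 , σ-perm , z≤n , e
  ... | no moved  = let (σ-perm , e) = insertMax-onto-moved moved in _ , _ , σ-perm , indexOf≤n moved , e

range₀ : ℕ → List ℕ
range₀ n = 0 ∷ range n

∈-range₀⁻ : ∀ n {x} → x ∈ range₀ n → x ≤ n
∈-range₀⁻ n (here refl) = z≤n
∈-range₀⁻ n (there m)   = proj₂ (∈-range⁻ n m)

∈-range₀⁺ : ∀ n {x} → x ≤ n → x ∈ range₀ n
∈-range₀⁺ n {zero}  _   = here refl
∈-range₀⁺ n {suc x} x≤n = there (∈-range⁺ n (s≤s z≤n , x≤n))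

distinct-range₀ : ∀ n → Distinct (range₀ n)
distinct-range₀ n = (λ m → <⇒≢ (proj₁ (∈-range⁻ n m)) refl) ∷ distinct-range n

insertions : ℕ → List (List ℕ)
insertions n = concatMap (λ σ → map (insertMax n σ) (range₀ n)) (perms n)

distinct-insertions : ∀ n → Distinct (insertions n)
distinct-insertions n =
  distinct-concatMap _ (proj₁ ∘ removeMax n) (perms n) (distinct-perms n)
    (λ mσ → distinct-map _ (range₀ n) (distinct-range₀ n) (λ ma mb e →
       trans (sym (removeMax-position mσ ma)) (trans (cong (proj₂ ∘ removeMax n) e) (removeMax-position mσ mb))))
    λ mσ mτ → let (x , mx , e) = ∈-map⁻ _ mτ in
      trans (cong (proj₁ ∘ removeMax n) e) (cong proj₁ (removeMax-insertMax (∈perms⇒IsPerm n mσ) x (∈-range₀⁻ n mx)))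
  where
  removeMax-position : ∀ {σ x} → σ ∈ perms n → x ∈ range₀ n → proj₂ (removeMax n (insertMax n σ x)) ≡ x
  removeMax-position mσ mx = cong proj₂ (removeMax-insertMax (∈perms⇒IsPerm n mσ) _ (∈-range₀⁻ n mx))

∑-perms-suc : ∀ n (f : List ℕ → ℕ) → ∑ f (perms (suc n)) ≡ ∑ (λ σ → ∑ (f ∘ insertMax n σ) (range₀ n)) (perms n)
∑-perms-suc n f = begin
  ∑ f (perms (suc n))                                      ≡⟨ ∑-sameElements f _ _ (distinct-perms (suc n)) (distinct-insertions n) onto into ⟩
  ∑ f (insertions n)                                       ≡⟨ ∑-concatMap f _ (perms n) ⟩
  ∑ (λ σ → ∑ f (map (insertMax n σ) (range₀ n))) (perms n) ≡⟨ ∑-cong _ _ (perms n) (λ {σ} _ → ∑-map f (insertMax n σ) (range₀ n)) ⟩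
  ∑ (λ σ → ∑ (f ∘ insertMax n σ) (range₀ n)) (perms n)     ∎
  where
  open ≡-Reasoning
  onto : perms (suc n) ⊆ insertions n
  onto m with insertMax-onto (∈perms⇒IsPerm (suc n) m)
  ... | σ , x , σ-perm , x≤n , refl =
    ∈-concatMap⁺ _ (perms n) (IsPerm⇒∈perms n σ-perm) (∈-map⁺ (insertMax n σ) (∈-range₀⁺ n x≤n))
  into : insertions n ⊆ perms (suc n)
  into m with ∈-concatMap⁻ _ (perms n) m
  ... | σ , mσ , mτ with ∈-map⁻ _ mτ
  ... | x , mx , refl = IsPerm⇒∈perms (suc n) (insertMax-isPerm (∈perms⇒IsPerm n mσ) x (∈-range₀⁻ n mx))

-- Removing the letters above m

iterate : (ℕ → ℕ) → ℕ → ℕ → ℕ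
iterate f zero    y = y
iterate f (suc k) y = iterate f k (f y)

iterate-suc : ∀ f k y → iterate f (suc k) y ≡ f (iterate f k y)
iterate-suc f zero    y = refl
iterate-suc f (suc k) y = iterate-suc f k (f y)

≤⇒∃+ : ∀ {a b} → a ≤ b → ∃[ d ] (a + d ≡ b)
≤⇒∃+ {zero}  {b}     _       = b , refl
≤⇒∃+ {suc a} {suc b} (s≤s q) with ≤⇒∃+ q
... | d , e = d , cong suc e

module _ {n : ℕ} {σ : List ℕ} (p : IsPerm n σ) where

  iterate-rng : ∀ k y → InRange n y → InRange n (iterate (app σ) k y)
  iterate-rng zero    y r = r
  iterate-rng (suc k) y r = iterate-rng k (app σ y) (rng p y r)

  iterate-cancel : ∀ a d u → InRange n u → iterate (app σ) a u ≡ iterate (app σ) (a + d) u → u ≡ iterate (app σ) d u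
  iterate-cancel zero    d u r e = e
  iterate-cancel (suc a) d u r e =
    iterate-cancel a d u r (inj p _ _ (iterate-rng a u r) (iterate-rng (a + d) u r)
      (trans (sym (iterate-suc (app σ) a u)) (trans e (iterate-suc (app σ) (a + d) u))))

  -- A collision σⁱ y = σ⁽ⁱ⁺ᵈ⁾ y forces σᵈ y = y ≤ m.
  orbit-recurrence : ∀ m y → InRange n y → y ≤ m → ∀ i j → i < j →
    iterate (app σ) i y ≡ iterate (app σ) j y → ∃[ d ] (1 ≤ d × d ≤ j × iterate (app σ) d y ≤ m)
  orbit-recurrence m y r y≤m i j i<j e with ≤⇒∃+ (<⇒≤ i<j)
  ... | d , refl = d , +-cancelˡ-< i 0 d (subst (_< i + d) (sym (+-identityʳ i)) i<j) , m≤n+m d i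
                     , ≤-trans (≤-reflexive (sym (iterate-cancel i d y r e))) y≤m

FirstReturn : ℕ → (ℕ → ℕ) → ℕ → ℕ → Set
FirstReturn m s k y = (∀ i → 1 ≤ i → i < k → m < iterate s i y) × iterate s k y ≤ m

FirstReturn-tail : ∀ {m s k y} → FirstReturn m s (suc (suc k)) y → FirstReturn m s (suc k) (s y)
FirstReturn-tail (above , back) = (λ i i≥1 i<k → above (suc i) (s≤s z≤n) (s≤s i<k)) , back

FirstReturn-head : ∀ {m s k y} → FirstReturn m s (suc (suc k)) y → m < s y
FirstReturn-head (above , _) = above 1 (s≤s z≤n) (s≤s (s≤s z≤n))

restrictAt-firstReturn : ∀ w m k fuel y → 1 ≤ k → k ≤ fuel → FirstReturn m (app w) k y →
  restrictAt w m fuel y ≡ iterate (app w) k y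
restrictAt-firstReturn w m (suc zero)    (suc fuel) y _ _         (_ , back) = if-true (≤ᵇ-true back)
restrictAt-firstReturn w m (suc (suc k)) (suc fuel) y _ (s≤s k≤f) ret =
  trans (if-false (≤ᵇ-false (<⇒≱ (FirstReturn-head ret))))
        (restrictAt-firstReturn w m (suc k) fuel (app w y) (s≤s z≤n) k≤f (FirstReturn-tail ret))

firstReturn-within : ∀ m s y f → (∃[ k ] (1 ≤ k × k ≤ f × FirstReturn m s k y)) ⊎ (∀ i → 1 ≤ i → i ≤ f → m < iterate s i y)
firstReturn-within m s y zero = inj₂ (λ i i≥1 i≤0 → ⊥-elim (<⇒≱ i≥1 i≤0))
firstReturn-within m s y (suc f) with firstReturn-within m s y f
... | inj₁ (k , k≥1 , k≤f , ret) = inj₁ (k , k≥1 , m≤n⇒m≤1+n k≤f , ret)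
... | inj₂ above with iterate s (suc f) y ≤? m
...   | yes back = inj₁ (suc f , s≤s z≤n , ≤-refl , (λ i i≥1 i≤f → above i i≥1 (≤-pred i≤f)) , back)
...   | no stays = inj₂ λ i i≥1 i≤ → [ (λ { (s≤s i≤f) → above i i≥1 i≤f }) , (λ { refl → ≰⇒> stays }) ]′ (m≤n⇒m<n∨m≡n i≤)

module _ {n : ℕ} {σ : List ℕ} (p : IsPerm n σ) where

  private
    s = app σ

  -- Otherwise the orbit points 1, …, n together with [1, m] would be n + m distinct elements of [1, n].
  firstReturn-exists : ∀ m y → InRange n y → y ≤ m → m ≤ n → ∃[ k ] (1 ≤ k × k ≤ n × FirstReturn m s k y)
  firstReturn-exists m y r y≤m m≤n with firstReturn-within m s y n
  ... | inj₁ found = found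
  ... | inj₂ above = ⊥-elim (<⇒≱ tooLong (length-mono-⊆ L (range n) distinct-L L⊆))
    where
    orbit = map (λ i → iterate s i y) (range n)
    L = orbit ++ range m
    never-back : ∀ i j → InRange n i → InRange n j → i < j → iterate s i y ≢ iterate s j y
    never-back i j ri rj i<j e with orbit-recurrence p m y r y≤m i j i<j e
    ... | d , d≥1 , d≤j , back = <⇒≱ (above d d≥1 (≤-trans d≤j (proj₂ rj))) back
    orbit-inj : ∀ {i j} → i ∈ range n → j ∈ range n → iterate s i y ≡ iterate s j y → i ≡ j
    orbit-inj {i} {j} mi mj e with <-cmp i j
    ... | tri≈ _ i≡j _ = i≡j
    ... | tri< i<j _ _ = ⊥-elim (never-back i j (∈-range⁻ n mi) (∈-range⁻ n mj) i<j e)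
    ... | tri> _ _ j<i = ⊥-elim (never-back j i (∈-range⁻ n mj) (∈-range⁻ n mi) j<i (sym e))
    distinct-L : Distinct L
    distinct-L = distinct-++ orbit (range m) (distinct-map _ (range n) (distinct-range n) orbit-inj) (distinct-range m)
      λ ma mb → let (i , mi , e) = ∈-map⁻ _ ma ; (i≥1 , i≤n) = ∈-range⁻ n mi in
        <⇒≱ (above i i≥1 i≤n) (subst (_≤ m) e (proj₂ (∈-range⁻ m mb)))
    L⊆ : L ⊆ range n
    L⊆ ma with ∈-++⁻ orbit ma
    ... | inj₁ q = let (i , mi , e) = ∈-map⁻ _ q in subst (_∈ range n) (sym e) (∈-range⁺ n (iterate-rng p i y r))
    ... | inj₂ q = let (a≥1 , a≤m) = ∈-range⁻ m q in ∈-range⁺ n (a≥1 , ≤-trans a≤m m≤n)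
    tooLong : length (range n) < length L
    tooLong = subst₂ _<_ (sym (length-range n))
      (sym (trans (length-++ orbit) (cong₂ _+_ (trans (length-map _ (range n)) (length-range n)) (length-range m))))
      (subst (_≤ n + m) (+-comm n 1) (+-monoʳ-≤ n (≤-trans (proj₁ r) y≤m)))

  restrict-full : ∀ y → InRange n y → restrict σ n y ≡ s y
  restrict-full y r = trans (cong (λ f → restrictAt σ n f y) (len p)) (full n r)
    where
    full : ∀ fuel → InRange fuel y → restrictAt σ n fuel y ≡ s y
    full zero       (y≥1 , y≤0) = ⊥-elim (<⇒≱ y≥1 y≤0)
    full (suc fuel) _           = if-true (≤ᵇ-true (proj₂ (rng p y r)))

firstHit : ∀ (s : ℕ → ℕ) x y k →
  (∀ i → i < k → iterate s i y ≢ x) ⊎ (∃[ a ] (a < k × iterate s a y ≡ x × (∀ i → i < a → iterate s i y ≢ x)))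
firstHit s x y zero = inj₁ (λ i ())
firstHit s x y (suc k) with firstHit s x y k
... | inj₂ (a , a<k , hit , before) = inj₂ (a , m≤n⇒m≤1+n a<k , hit , before)
... | inj₁ avoids with iterate s k y ≟ x
...   | yes hit = inj₂ (k , ≤-refl , hit , avoids)
...   | no miss = inj₁ λ i i< → [ (λ { (s≤s i<k) → avoids i i<k }) , (λ { refl → miss }) ]′ (m≤n⇒m<n∨m≡n i<)

module _ {n : ℕ} {σ : List ℕ} (p : IsPerm n σ) (x : ℕ) (x≤n : x ≤ n) (m : ℕ) (m≤n : m ≤ n) where

  private
    s = app σ
    τ = insertMax n σ x

  restrictAt-insertMax-avoiding : ∀ k z fuel → 1 ≤ k → k ≤ fuel → InRange n z → FirstReturn m s k z →
    (∀ i → i < k → iterate s i z ≢ x) → restrictAt τ m fuel z ≡ iterate s k z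
  restrictAt-insertMax-avoiding (suc zero) z (suc fuel) _ _ r (_ , back) avoids =
    let τz = insertMax-other p x z r (avoids 0 (s≤s z≤n)) in
    trans (if-true (≤ᵇ-true (subst (_≤ m) (sym τz) back))) τz
  restrictAt-insertMax-avoiding (suc (suc k)) z (suc fuel) _ (s≤s k≤f) r ret avoids =
    let τz = insertMax-other p x z r (avoids 0 (s≤s z≤n)) in
    trans (if-false (≤ᵇ-false (λ le → <⇒≱ (FirstReturn-head ret) (subst (_≤ m) τz le))))
      (trans (cong (restrictAt τ m fuel) τz)
        (restrictAt-insertMax-avoiding (suc k) (s z) fuel (s≤s z≤n) k≤f (rng p z r) (FirstReturn-tail ret)
          (λ i i<k → avoids (suc i) (s≤s i<k))))

  -- Passing through x, the orbit in τ takes the detour x ↦ n + 1 ↦ σ x: one extra step.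
  restrictAt-insertMax-through : ∀ a k z fuel → a < k → suc k ≤ fuel → InRange n z → FirstReturn m s k z →
    iterate s a z ≡ x → (∀ i → i < k → i ≢ a → iterate s i z ≢ x) → 1 ≤ x → restrictAt τ m fuel z ≡ iterate s k z
  restrictAt-insertMax-through zero k z (suc zero) a<k (s≤s k≤0) _ _ _ _ _ = ⊥-elim (<⇒≱ a<k k≤0)
  restrictAt-insertMax-through zero k z (suc (suc fuel)) a<k (s≤s k≤f) r ret refl avoids x≥1 =
    trans (if-false (≤ᵇ-false (λ le → <⇒≱ (s≤s m≤n) (subst (_≤ m) τz le))))
      (trans (cong (restrictAt τ m (suc fuel)) τz) (fromTop k a<k k≤f ret avoids))
    where
    τz = insertMax-at p z (x≥1 , x≤n)
    fromTop : ∀ k → 0 < k → k ≤ suc fuel → FirstReturn m s k z → (∀ i → i < k → i ≢ 0 → iterate s i z ≢ z) →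
      restrictAt τ m (suc fuel) (suc n) ≡ iterate s k z
    fromTop (suc zero) _ _ (_ , back) _ =
      trans (if-true (≤ᵇ-true (subst (_≤ m) (sym (insertMax-top p z x≥1)) back))) (insertMax-top p z x≥1)
    fromTop (suc (suc k)) _ (s≤s k≤f) ret avoids′ =
      trans (if-false (≤ᵇ-false (λ le → <⇒≱ (FirstReturn-head ret) (subst (_≤ m) (insertMax-top p z x≥1) le))))
        (trans (cong (restrictAt τ m fuel) (insertMax-top p z x≥1))
          (restrictAt-insertMax-avoiding (suc k) (s z) fuel (s≤s z≤n) k≤f (rng p z r) (FirstReturn-tail ret)
            (λ i i<k → avoids′ (suc i) (s≤s i<k) (λ ()))))
  restrictAt-insertMax-through (suc a) (suc (suc k)) z (suc fuel) (s≤s a<k) (s≤s k≤f) r ret hit avoids x≥1 =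
    let τz = insertMax-other p x z r (avoids 0 (s≤s z≤n) (λ ())) in
    trans (if-false (≤ᵇ-false (λ le → <⇒≱ (FirstReturn-head ret) (subst (_≤ m) τz le))))
      (trans (cong (restrictAt τ m fuel) τz)
        (restrictAt-insertMax-through a (suc k) (s z) fuel a<k k≤f (rng p z r) (FirstReturn-tail ret) hit
          (λ i i<k i≢a → avoids (suc i) (s≤s i<k) (i≢a ∘ suc-injective)) x≥1))

  restrictAt-insertMax-firstReturn : ∀ k y → 1 ≤ k → k ≤ n → InRange n y → y ≤ m → FirstReturn m s k y →
    restrictAt τ m (suc n) y ≡ iterate s k y
  restrictAt-insertMax-firstReturn k y k≥1 k≤n r y≤m ret with firstHit s x y k
  ... | inj₁ avoids = restrictAt-insertMax-avoiding k y (suc n) k≥1 (m≤n⇒m≤1+n k≤n) r ret avoids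
  ... | inj₂ (a , a<k , hit , before) =
    restrictAt-insertMax-through a k y (suc n) a<k (s≤s k≤n) r ret hit onlyOnce x≥1
    where
    x≥1 : 1 ≤ x
    x≥1 = subst (1 ≤_) hit (proj₁ (iterate-rng p a y r))
    onlyOnce : ∀ i → i < k → i ≢ a → iterate s i y ≢ x
    onlyOnce i i<k i≢a again with <-cmp i a
    ... | tri< i<a _ _ = before i i<a again
    ... | tri≈ _ i≡a _ = i≢a i≡a
    ... | tri> _ _ a<i with orbit-recurrence p m y r y≤m a i a<i (trans hit (sym again))
    ...   | d , d≥1 , d≤i , back = <⇒≱ (proj₁ ret d d≥1 (<-≤-trans (s≤s d≤i) i<k)) back

  restrict-insertMax : ∀ y → InRange m y → restrict τ m y ≡ restrict σ m y
  restrict-insertMax y (y≥1 , y≤m) with firstReturn-exists p m y (y≥1 , ≤-trans y≤m m≤n) y≤m m≤n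
  ... | k , k≥1 , k≤n , ret = begin
    restrictAt τ m (length τ) y ≡⟨ cong (λ f → restrictAt τ m f y) (length-insertMax p x) ⟩
    restrictAt τ m (suc n) y    ≡⟨ restrictAt-insertMax-firstReturn k y k≥1 k≤n (y≥1 , ≤-trans y≤m m≤n) y≤m ret ⟩
    iterate s k y               ≡⟨ sym (restrictAt-firstReturn σ m k n y k≥1 k≤n ret) ⟩
    restrictAt σ m n y          ≡⟨ cong (λ f → restrictAt σ m f y) (sym (len p)) ⟩
    restrictAt σ m (length σ) y ∎
    where open ≡-Reasoning

-- Cycle double ascents and the simsun condition under insertion

CycleDoubleAscent : ℕ → (ℕ → ℕ) → Set
CycleDoubleAscent m f = ∃[ a ] ∃[ b ] (InRange m a × InRange m b × f b ≡ a × b < a × a < f a)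

hasCDA⇒CDA : ∀ m f → hasCDA m f ≡ true → CycleDoubleAscent m f
hasCDA⇒CDA m f e with any-true⁻ _ (range m) e
... | a , ma , e₁ with ∧-true⁻ e₁
... | e₂ , a< with any-true⁻ _ (range m) e₂
... | b , mb , e₃ with ∧-true⁻ e₃
... | fb , b< = a , b , ∈-range⁻ m ma , ∈-range⁻ m mb , ≡ᵇ-true⁻ fb , <ᵇ-true⁻ b< , <ᵇ-true⁻ a<

CDA⇒hasCDA : ∀ m f → CycleDoubleAscent m f → hasCDA m f ≡ true
CDA⇒hasCDA m f (a , b , ra , rb , fb , b<a , a<fa) =
  any-true _ (range m) (∈-range⁺ m ra)
    (∧-true (any-true _ (range m) (∈-range⁺ m rb) (∧-true (≡ᵇ-true fb) (<ᵇ-true b<a))) (<ᵇ-true a<fa))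

hasCDA-cong : ∀ m (f g : ℕ → ℕ) → (∀ y → InRange m y → f y ≡ g y) → hasCDA m f ≡ hasCDA m g
hasCDA-cong m f g f≗g = any-cong _ _ (range m) λ {a} ma →
  cong₂ _∧_ (any-cong _ _ (range m) (λ {b} mb → cong (λ z → (z ≡ᵇ a) ∧ (b <ᵇ a)) (f≗g b (∈-range⁻ m mb))))
            (cong (a <ᵇ_) (f≗g a (∈-range⁻ m ma)))

-- The conditions for k = 1, …, n on τ = insertMax n σ x are those for k = 0, …, n - 1 on σ.
isSimsun₂-insertMax : ∀ {n σ} (p : IsPerm n σ) x → x ≤ n →
  isSimsun₂ (suc n) (insertMax n σ x) ≡ not (hasCDA (suc n) (app (insertMax n σ x))) ∧ isSimsun₂ n σ
isSimsun₂-insertMax {n} {σ} p x x≤n = cong₂ _∧_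
  (cong not (hasCDA-cong (suc n) _ _ (restrict-full (insertMax-isPerm p x x≤n))))
  (all-applyUpTo-cong n suc (λ k → k) _ _ λ k _ →
     cong not (hasCDA-cong (n ∸ k) _ _ (restrict-insertMax p x x≤n (n ∸ k) (m∸n≤m n k))))

isSimsun₂⇒¬hasCDA : ∀ {n σ} → IsPerm n σ → isSimsun₂ n σ ≡ true → hasCDA n (app σ) ≡ false
isSimsun₂⇒¬hasCDA {zero}  p e = refl
isSimsun₂⇒¬hasCDA {suc n} {σ} p e =
  trans (hasCDA-cong (suc n) _ _ (λ y r → sym (restrict-full p y r))) (not-true⁻ (proj₁ (∧-true⁻ e)))

preimageAbove : ℕ → List ℕ → ℕ → Bool
preimageAbove n σ x = any (λ b → (app σ b ≡ᵇ x) ∧ (x <ᵇ b)) (range n)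

insertionAllowed : ℕ → List ℕ → ℕ → Bool
insertionAllowed n σ zero    = true
insertionAllowed n σ (suc x) = (app σ (suc x) ≡ᵇ suc x) ∨ preimageAbove n σ (suc x)

module _ {n : ℕ} {σ : List ℕ} (p : IsPerm n σ) where

  private
    s = app σ

  preimageAbove⁻ : ∀ x b → InRange n b → s b ≡ x → preimageAbove n σ x ≡ true → x < b
  preimageAbove⁻ x b rb sb≡x e with any-true⁻ _ (range n) e
  ... | b′ , mb′ , e′ with ∧-true⁻ e′
  ... | sb′≡x , x<b′ = subst (x <_) (inj p b′ b (∈-range⁻ n mb′) rb (trans (≡ᵇ-true⁻ sb′≡x) (sym sb≡x))) (<ᵇ-true⁻ x<b′)

  preimageAbove⁺ : ∀ x b → InRange n b → s b ≡ x → x < b → preimageAbove n σ x ≡ true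
  preimageAbove⁺ x b rb sb≡x x<b = any-true _ (range n) (∈-range⁺ n rb) (∧-true (≡ᵇ-true sb≡x) (<ᵇ-true x<b))

  module _ (x : ℕ) (x≤n : x ≤ n) where

    private
      τ = insertMax n σ x

    -- A cycle double ascent of τ not at x is one of σ; one at x has σ⁻¹(x) < x.
    ¬CDA-insertMax : hasCDA n s ≡ false → insertionAllowed n σ x ≡ true → ¬ CycleDoubleAscent (suc n) (app τ)
    ¬CDA-insertMax noCDA allowed (a , b , ra , rb , τb≡a , b<a , a<τa) with m≤n⇒m<n∨m≡n (proj₂ ra)
    ... | inj₂ refl = <⇒≱ a<τa (proj₂ (insertMax-rng p x x≤n (suc n) ra))
    ... | inj₁ (s≤s a≤n) with a ≟ x
    ...   | no a≢x = true≢false (trans (sym (CDA⇒hasCDA n s cda)) noCDA)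
      where
      rb′ : InRange n b
      rb′ = proj₁ rb , ≤-trans (<⇒≤ b<a) a≤n
      b≢x : b ≢ x
      b≢x refl = <⇒≢ (s≤s a≤n) (trans (sym τb≡a) (insertMax-at p b (proj₁ rb , x≤n)))
      cda : CycleDoubleAscent n s
      cda = a , b , (proj₁ ra , a≤n) , rb′ , trans (sym (insertMax-other p x b rb′ b≢x)) τb≡a , b<a
          , subst (a <_) (insertMax-other p x a (proj₁ ra , a≤n) a≢x) a<τa
    ...   | yes refl = disallowed x refl allowed
      where
      rb′ : InRange n b
      rb′ = proj₁ rb , ≤-trans (<⇒≤ b<a) a≤n
      sb≡a : s b ≡ a
      sb≡a = trans (sym (insertMax-other p a b rb′ (<⇒≢ b<a))) τb≡a
      disallowed : ∀ x′ → x′ ≡ a → insertionAllowed n σ x′ ≡ true → ⊥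
      disallowed zero    refl _ = <⇒≱ b<a z≤n
      disallowed (suc _) refl e with ∨-true⁻ e
      ... | inj₁ fixed = <⇒≢ b<a (inj p b a rb′ (proj₁ ra , a≤n) (trans sb≡a (sym (≡ᵇ-true⁻ fixed))))
      ... | inj₂ above = <-asym b<a (preimageAbove⁻ a b rb′ sb≡a above)

    -- Otherwise σ⁻¹(x) < x < n + 1 = τ x.
    CDA-insertMax : insertionAllowed n σ x ≡ false → CycleDoubleAscent (suc n) (app τ)
    CDA-insertMax = disallowed x refl
      where
      disallowed : ∀ x′ → x′ ≡ x → insertionAllowed n σ x′ ≡ false → CycleDoubleAscent (suc n) (app τ)
      disallowed zero    _    ()
      disallowed (suc _) refl e with ∨-false⁻ e | IsPerm-surjective n p x (s≤s z≤n , x≤n)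
      ... | notFixed , notAbove | b , rb , sb≡x with b ≟ x
      ...   | yes refl = ⊥-elim (≡ᵇ-false⁻ notFixed sb≡x)
      ...   | no b≢x with b <? x
      ...     | yes b<x = x , b , InRange-suc (s≤s z≤n , x≤n) , InRange-suc rb
                        , trans (insertMax-other p x b rb b≢x) sb≡x , b<x
                        , subst (x <_) (sym (insertMax-at p x (s≤s z≤n , x≤n))) (s≤s x≤n)
      ...     | no b≮x = ⊥-elim (true≢false (trans (sym (preimageAbove⁺ x b rb sb≡x x<b)) notAbove))
        where
        x<b : x < b
        x<b = ≤∧≢⇒< (≮⇒≥ b≮x) (b≢x ∘ sym)

    not-hasCDA-insertMax : hasCDA n s ≡ false → not (hasCDA (suc n) (app τ)) ≡ insertionAllowed n σ x
    not-hasCDA-insertMax noCDA with insertionAllowed n σ x in allowed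
    ... | true  = not-false (¬T⇒≡false (λ t → ¬CDA-insertMax noCDA allowed (hasCDA⇒CDA (suc n) (app τ) (T⇒≡true t))))
    ... | false = cong not (CDA⇒hasCDA (suc n) (app τ) (CDA-insertMax allowed))

-- Fixed points and excedances under insertion

fixCount excCount : ℕ → List ℕ → ℕ
fixCount n w = count (λ y → app w y ≡ᵇ y) (range n)
excCount n w = count (λ y → y <ᵇ app w y) (range n)

∑-update : (f g : ℕ → ℕ) (L : List ℕ) (x : ℕ) → Distinct L → x ∈ L → (∀ {y} → y ∈ L → y ≢ x → f y ≡ g y) →
  ∑ f L + g x ≡ ∑ g L + f x
∑-update f g (z ∷ zs) x (z∉ ∷ _) (here refl) f≗g =
  trans (cong (λ k → f z + k + g z) (∑-cong f g zs (λ m → f≗g (there m) (∉⇒≢ z∉ m)))) (swap (f z) (∑ g zs) (g z))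
  where
  swap : ∀ a b c → a + b + c ≡ c + b + a
  swap = solve-∀
∑-update f g (z ∷ zs) x (z∉ ∷ d) (there m) f≗g =
  trans (cong (λ k → k + ∑ f zs + g x) (f≗g (here refl) (∉⇒≢ z∉ m ∘ sym)))
    (trans (+-assoc (g z) (∑ f zs) (g x))
      (trans (cong (g z +_) (∑-update f g zs x d m (f≗g ∘ there))) (sym (+-assoc (g z) _ _))))

module _ {n : ℕ} {σ : List ℕ} (p : IsPerm n σ) where

  private
    s = app σ
    insertMax-zero-below : ∀ {y} → y ∈ range n → app (insertMax n σ 0) y ≡ s y
    insertMax-zero-below m = let r = ∈-range⁻ n m in insertMax-other p 0 _ r (λ e → <⇒≢ (proj₁ r) (sym e))

  fixCount-insertMax-zero : fixCount (suc n) (insertMax n σ 0) ≡ suc (fixCount n σ)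
  fixCount-insertMax-zero = trans (∑-range-suc _ n) (trans (cong₂ _+_
    (∑-cong _ _ (range n) (λ {y} m → cong (λ k → χ (k ≡ᵇ y)) (insertMax-zero-below m)))
    (χ-true (≡ᵇ-true (insertMax-top-fixed p)))) (+-comm _ 1))

  excCount-insertMax-zero : excCount (suc n) (insertMax n σ 0) ≡ excCount n σ
  excCount-insertMax-zero = trans (∑-range-suc _ n) (trans (cong₂ _+_
    (∑-cong _ _ (range n) (λ {y} m → cong (λ k → χ (y <ᵇ k)) (insertMax-zero-below m)))
    (χ-false (<ᵇ-false (<-irrefl (sym (insertMax-top-fixed p)))))) (+-identityʳ _))

  module _ (x : ℕ) (rx : InRange n x) where

    private
      τ = insertMax n σ x
      t = app τ
      τx : t x ≡ suc n
      τx = insertMax-at p x rx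
      τtop : t (suc n) ≡ s x
      τtop = insertMax-top p x (proj₁ rx)
      σx≤n : s x ≤ n
      σx≤n = proj₂ (rng p x rx)
      insertMax-below : ∀ {y} → y ∈ range n → y ≢ x → t y ≡ s y
      insertMax-below m = insertMax-other p x _ (∈-range⁻ n m)

    -- x stops being a fixed point (if it was one), and n + 1 is not fixed.
    fixCount-insertMax : fixCount (suc n) τ + χ (s x ≡ᵇ x) ≡ fixCount n σ
    fixCount-insertMax = begin
      fixCount (suc n) τ + χ (s x ≡ᵇ x)
        ≡⟨ cong (_+ χ (s x ≡ᵇ x)) (trans (∑-range-suc _ n) (cong (∑ (λ y → χ (t y ≡ᵇ y)) (range n) +_) topNotFixed)) ⟩
      ∑ (λ y → χ (t y ≡ᵇ y)) (range n) + 0 + χ (s x ≡ᵇ x)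
        ≡⟨ cong (_+ χ (s x ≡ᵇ x)) (+-identityʳ _) ⟩
      ∑ (λ y → χ (t y ≡ᵇ y)) (range n) + χ (s x ≡ᵇ x)
        ≡⟨ ∑-update _ _ (range n) x (distinct-range n) (∈-range⁺ n rx) (λ m y≢x → cong (λ k → χ (k ≡ᵇ _)) (insertMax-below m y≢x)) ⟩
      fixCount n σ + χ (t x ≡ᵇ x)
        ≡⟨ cong (λ k → fixCount n σ + χ k) (≡ᵇ-false (λ e → <⇒≢ (s≤s (proj₂ rx)) (sym (trans (sym τx) e)))) ⟩
      fixCount n σ + 0
        ≡⟨ +-identityʳ _ ⟩
      fixCount n σ ∎
      where
      open ≡-Reasoning
      topNotFixed : χ (t (suc n) ≡ᵇ suc n) ≡ 0
      topNotFixed = χ-false (≡ᵇ-false (λ e → <⇒≢ (s≤s σx≤n) (trans (sym τtop) e)))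

    -- x becomes an excedance (if it was not one), and n + 1 is not an excedance.
    excCount-insertMax : excCount (suc n) τ + χ (x <ᵇ s x) ≡ suc (excCount n σ)
    excCount-insertMax = begin
      excCount (suc n) τ + χ (x <ᵇ s x)
        ≡⟨ cong (_+ χ (x <ᵇ s x)) (trans (∑-range-suc _ n) (cong (∑ (λ y → χ (y <ᵇ t y)) (range n) +_) topNoExc)) ⟩
      ∑ (λ y → χ (y <ᵇ t y)) (range n) + 0 + χ (x <ᵇ s x)
        ≡⟨ cong (_+ χ (x <ᵇ s x)) (+-identityʳ _) ⟩
      ∑ (λ y → χ (y <ᵇ t y)) (range n) + χ (x <ᵇ s x)
        ≡⟨ ∑-update _ _ (range n) x (distinct-range n) (∈-range⁺ n rx) (λ m y≢x → cong (λ k → χ (_ <ᵇ k)) (insertMax-below m y≢x)) ⟩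
      excCount n σ + χ (x <ᵇ t x)
        ≡⟨ cong (λ k → excCount n σ + χ k) (<ᵇ-true (subst (x <_) (sym τx) (s≤s (proj₂ rx)))) ⟩
      excCount n σ + 1
        ≡⟨ +-comm _ 1 ⟩
      suc (excCount n σ) ∎
      where
      open ≡-Reasoning
      topNoExc : χ (suc n <ᵇ t (suc n)) ≡ 0
      topNoExc = χ-false (<ᵇ-false (λ lt → <⇒≱ (subst (suc n <_) τtop lt) (m≤n⇒m≤1+n σx≤n)))

    fixCount-insertMax-fixed : s x ≡ x → fixCount (suc n) τ ≡ fixCount n σ ∸ 1
    fixCount-insertMax-fixed fixed = trans (sym (m+n∸n≡m _ 1))
      (cong (_∸ 1) (subst (λ b → fixCount (suc n) τ + χ b ≡ fixCount n σ) (≡ᵇ-true fixed) fixCount-insertMax))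

    fixCount-insertMax-moved : s x ≢ x → fixCount (suc n) τ ≡ fixCount n σ
    fixCount-insertMax-moved moved = trans (sym (+-identityʳ _))
      (subst (λ b → fixCount (suc n) τ + χ b ≡ fixCount n σ) (≡ᵇ-false moved) fixCount-insertMax)

    excCount-insertMax-exc : x < s x → excCount (suc n) τ ≡ excCount n σ
    excCount-insertMax-exc x<sx = suc-injective (trans (+-comm 1 _)
      (subst (λ b → excCount (suc n) τ + χ b ≡ suc (excCount n σ)) (<ᵇ-true x<sx) excCount-insertMax))

    excCount-insertMax-nonExc : ¬ x < s x → excCount (suc n) τ ≡ suc (excCount n σ)
    excCount-insertMax-nonExc x≮sx = trans (sym (+-identityʳ _))
      (subst (λ b → excCount (suc n) τ + χ b ≡ suc (excCount n σ)) (<ᵇ-false x≮sx) excCount-insertMax)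

-- The contribution of one σ ∈ 𝔖ₙ to the count in 𝔖ₙ₊₁

trichotomyᵇ : ∀ a b → χ (a ≡ᵇ b) + (χ (b <ᵇ a) + χ (a <ᵇ b)) ≡ 1
trichotomyᵇ zero    zero    = refl
trichotomyᵇ zero    (suc b) = refl
trichotomyᵇ (suc a) zero    = refl
trichotomyᵇ (suc a) (suc b) = trichotomyᵇ a b

simsun₂With : ℕ → ℕ → ℕ → List ℕ → Bool
simsun₂With n i j w = isSimsun₂ n w ∧ ((fixCount n w ≡ᵇ i) ∧ (excCount n w ≡ᵇ j))

simsun₂Count≡count : ∀ n i j → simsun₂Count n i j ≡ count (simsun₂With n i j) (perms n)
simsun₂Count≡count n i j = trans (length-filterᵇ _ (perms n)) (∑-cong _ _ (perms n) λ {w} _ →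
  cong₂ (λ u v → χ (isSimsun₂ n w ∧ ((u ≡ᵇ i) ∧ (v ≡ᵇ j)))) (length-filterᵇ _ (range n)) (length-filterᵇ _ (range n)))

-- cycle double descents: σ⁻¹(y) > y > σ(y)
cddCount : ℕ → List ℕ → ℕ
cddCount n σ = count (λ y → (app σ y <ᵇ y) ∧ preimageAbove n σ y) (range n)

descCount : ℕ → List ℕ → ℕ
descCount n σ = count (λ y → app σ y <ᵇ y) (range n)

module _ {n : ℕ} {σ : List ℕ} (p : IsPerm n σ) where

  private
    s = app σ
    f = fixCount n σ
    e = excCount n σ

  fix+exc+desc : f + (e + descCount n σ) ≡ n
  fix+exc+desc = begin
    f + (e + descCount n σ)                                     ≡⟨ sym (trans (∑-+ _ _ (range n)) (cong (f +_) (∑-+ _ _ (range n)))) ⟩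
    ∑ (λ y → χ (s y ≡ᵇ y) + (χ (y <ᵇ s y) + χ (s y <ᵇ y))) (range n) ≡⟨ ∑-cong _ _ (range n) (λ {y} _ → trichotomyᵇ (s y) y) ⟩
    ∑ (λ _ → 1) (range n)                                       ≡⟨ ∑-const-1 (range n) ⟩
    length (range n)                                            ≡⟨ length-range n ⟩
    n                                                           ∎
    where
    open ≡-Reasoning

  count-preimageAbove : count (preimageAbove n σ) (range n) ≡ descCount n σ
  count-preimageAbove = begin
    count (preimageAbove n σ) (range n)           ≡⟨ ∑-sameElements _ (range n) (map s (range n)) (distinct-range n) distinct-image onto into ⟩
    count (preimageAbove n σ) (map s (range n))   ≡⟨ ∑-map _ s (range n) ⟩
    ∑ (λ y → χ (preimageAbove n σ (s y))) (range n) ≡⟨ ∑-cong _ _ (range n) (λ m → cong χ (preimageAbove-image _ (∈-range⁻ n m))) ⟩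
    descCount n σ                                 ∎
    where
    open ≡-Reasoning
    distinct-image : Distinct (map s (range n))
    distinct-image = distinct-map s (range n) (distinct-range n) (λ ma mb → inj p _ _ (∈-range⁻ n ma) (∈-range⁻ n mb))
    onto : range n ⊆ map s (range n)
    onto m with IsPerm-surjective n p _ (∈-range⁻ n m)
    ... | y , ry , refl = ∈-map⁺ s (∈-range⁺ n ry)
    into : map s (range n) ⊆ range n
    into m with ∈-map⁻ s m
    ... | y , my , refl = ∈-range⁺ n (rng p y (∈-range⁻ n my))
    preimageAbove-image : ∀ y → InRange n y → preimageAbove n σ (s y) ≡ (s y <ᵇ y)
    preimageAbove-image y ry with s y <? y
    ... | yes lt = trans (preimageAbove⁺ p (s y) y ry refl lt) (sym (<ᵇ-true lt))
    ... | no ¬lt = trans (¬T⇒≡false (λ t → ¬lt (preimageAbove⁻ p (s y) y ry refl (T⇒≡true t)))) (sym (<ᵇ-false ¬lt))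

  preimageAbove-fixed : ∀ x → InRange n x → s x ≡ x → preimageAbove n σ x ≡ false
  preimageAbove-fixed x rx fixed = ¬T⇒≡false λ t → <-irrefl refl (preimageAbove⁻ p x x rx fixed (T⇒≡true t))

  -- Otherwise x would be a cycle double ascent.
  preimageAbove-exc : hasCDA n s ≡ false → ∀ x → InRange n x → x < s x → preimageAbove n σ x ≡ true
  preimageAbove-exc noCDA x rx x<sx with IsPerm-surjective n p x rx
  ... | b , rb , sb≡x with <-cmp b x
  ... | tri≈ _ refl _ = ⊥-elim (<-irrefl (sym sb≡x) x<sx)
  ... | tri> _ _ x<b  = preimageAbove⁺ p x b rb sb≡x x<b
  ... | tri< b<x _ _  = ⊥-elim (true≢false (trans (sym (CDA⇒hasCDA n s (x , b , rx , rb , sb≡x , b<x , x<sx))) noCDA))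

  cdd+2exc+fix : hasCDA n s ≡ false → f + (e + (cddCount n σ + e)) ≡ n
  cdd+2exc+fix noCDA = trans (cong (λ k → f + (e + k)) (trans (sym split) count-preimageAbove)) fix+exc+desc
    where
    byCase : ∀ y → InRange n y → χ (preimageAbove n σ y) ≡ χ ((s y <ᵇ y) ∧ preimageAbove n σ y) + χ (y <ᵇ s y)
    byCase y ry with <-cmp (s y) y
    ... | tri≈ _ eq _ rewrite preimageAbove-fixed y ry eq | <ᵇ-false (<-irrefl eq) | <ᵇ-false (<-irrefl (sym eq)) = refl
    ... | tri< lt _ _ rewrite <ᵇ-true lt | <ᵇ-false (<-asym lt) = sym (+-identityʳ _)
    ... | tri> _ _ gt rewrite preimageAbove-exc noCDA y ry gt | <ᵇ-false (<-asym gt) | <ᵇ-true gt = refl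
    split : count (preimageAbove n σ) (range n) ≡ cddCount n σ + e
    split = trans (∑-cong _ _ (range n) (λ m → byCase _ (∈-range⁻ n m))) (∑-+ _ _ (range n))

module _ {n : ℕ} {σ : List ℕ} (p : IsPerm n σ) (i j : ℕ) where

  private
    s = app σ
    f = fixCount n σ
    e = excCount n σ

  insertionWeight : ℕ → ℕ
  insertionWeight x = χ (simsun₂With (suc n) i j (insertMax n σ x))

  insertionWeight-¬simsun : isSimsun₂ n σ ≡ false → ∀ x → x ≤ n → insertionWeight x ≡ 0
  insertionWeight-¬simsun notSimsun x x≤n
    rewrite isSimsun₂-insertMax p x x≤n | notSimsun | ∧-zeroʳ (not (hasCDA (suc n) (app (insertMax n σ x)))) = refl

  fixedWeight excWeight descWeight : ℕ
  fixedWeight = χ ((f ∸ 1 ≡ᵇ i) ∧ (suc e ≡ᵇ j))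
  excWeight   = χ ((f ≡ᵇ i) ∧ (e ≡ᵇ j))
  descWeight  = χ ((f ≡ᵇ i) ∧ (suc e ≡ᵇ j))

  module _ (simsun : isSimsun₂ n σ ≡ true) where

    private
      noCDA : hasCDA n s ≡ false
      noCDA = isSimsun₂⇒¬hasCDA p simsun

    insertionWeight-via : ∀ {x b F E} → x ≤ n → insertionAllowed n σ x ≡ b →
      fixCount (suc n) (insertMax n σ x) ≡ F → excCount (suc n) (insertMax n σ x) ≡ E →
      insertionWeight x ≡ χ (b ∧ ((F ≡ᵇ i) ∧ (E ≡ᵇ j)))
    insertionWeight-via {x} x≤n refl refl refl
      rewrite isSimsun₂-insertMax p x x≤n | simsun | ∧-identityʳ (not (hasCDA (suc n) (app (insertMax n σ x))))
            | not-hasCDA-insertMax p x x≤n noCDA = refl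

    insertionWeight-zero : insertionWeight 0 ≡ χ ((suc f ≡ᵇ i) ∧ (e ≡ᵇ j))
    insertionWeight-zero = insertionWeight-via z≤n refl (fixCount-insertMax-zero p) (excCount-insertMax-zero p)

    private
      allowed-pos : ∀ x → 1 ≤ x → insertionAllowed n σ x ≡ (s x ≡ᵇ x) ∨ preimageAbove n σ x
      allowed-pos (suc x) _ = refl

    insertionWeight-pos : ∀ x → InRange n x →
      insertionWeight x ≡ χ (s x ≡ᵇ x) * fixedWeight + (χ (x <ᵇ s x) * excWeight + χ ((s x <ᵇ x) ∧ preimageAbove n σ x) * descWeight)
    insertionWeight-pos x rx@(x≥1 , x≤n) with <-cmp (s x) x
    ... | tri≈ _ fixed _
      rewrite ≡ᵇ-true fixed | <ᵇ-false (<-irrefl (sym fixed)) | <ᵇ-false (<-irrefl fixed) =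
      trans (insertionWeight-via x≤n (trans (allowed-pos x x≥1) (cong (_∨ preimageAbove n σ x) (≡ᵇ-true fixed)))
                (fixCount-insertMax-fixed p x rx fixed) (excCount-insertMax-nonExc p x rx (<-irrefl (sym fixed))))
            (sym (trans (+-identityʳ _) (+-identityʳ fixedWeight)))
    ... | tri< desc _ _
      rewrite ≡ᵇ-false (λ e → <-irrefl e desc) | <ᵇ-false (<-asym desc) | <ᵇ-true desc =
      trans (insertionWeight-via x≤n (trans (allowed-pos x x≥1) (cong (_∨ preimageAbove n σ x) (≡ᵇ-false (λ e → <-irrefl e desc))))
                (fixCount-insertMax-moved p x rx (λ e → <-irrefl e desc)) (excCount-insertMax-nonExc p x rx (<-asym desc)))
            (χ-∧ (preimageAbove n σ x) ((f ≡ᵇ i) ∧ (suc e ≡ᵇ j)))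
    ... | tri> _ _ exc
      rewrite ≡ᵇ-false (λ e → <-irrefl (sym e) exc) | <ᵇ-true exc | <ᵇ-false (<-asym exc) =
      trans (insertionWeight-via x≤n (trans (allowed-pos x x≥1) (trans (cong (_∨ preimageAbove n σ x) (≡ᵇ-false (λ e → <-irrefl (sym e) exc)))
                                                                          (preimageAbove-exc p noCDA x rx exc)))
                (fixCount-insertMax-moved p x rx (λ e → <-irrefl (sym e) exc)) (excCount-insertMax-exc p x rx exc))
            (sym (trans (+-identityʳ _) (+-identityʳ excWeight)))

    ∑-insertionWeight-simsun : ∑ insertionWeight (range₀ n) ≡
      χ ((suc f ≡ᵇ i) ∧ (e ≡ᵇ j)) + (f * fixedWeight + (e * excWeight + cddCount n σ * descWeight))
    ∑-insertionWeight-simsun = cong₂ _+_ insertionWeight-zero (begin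
      ∑ insertionWeight (range n)
        ≡⟨ ∑-cong _ _ (range n) (λ m → insertionWeight-pos _ (∈-range⁻ n m)) ⟩
      ∑ (λ x → χ (s x ≡ᵇ x) * fixedWeight + (χ (x <ᵇ s x) * excWeight + χ ((s x <ᵇ x) ∧ preimageAbove n σ x) * descWeight)) (range n)
        ≡⟨ trans (∑-+ (λ x → χ (s x ≡ᵇ x) * fixedWeight) _ (range n)) (cong (∑ (λ x → χ (s x ≡ᵇ x) * fixedWeight) (range n) +_) (∑-+ _ _ (range n))) ⟩
      ∑ (λ x → χ (s x ≡ᵇ x) * fixedWeight) (range n) + (∑ (λ x → χ (x <ᵇ s x) * excWeight) (range n)
        + ∑ (λ x → χ ((s x <ᵇ x) ∧ preimageAbove n σ x) * descWeight) (range n))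
        ≡⟨ cong₂ _+_ (∑-*ʳ _ fixedWeight (range n)) (cong₂ _+_ (∑-*ʳ _ excWeight (range n)) (∑-*ʳ _ descWeight (range n))) ⟩
      f * fixedWeight + (e * excWeight + cddCount n σ * descWeight) ∎)
      where open ≡-Reasoning

  ∑-insertionWeight : ∑ insertionWeight (range₀ n) ≡
    χ (isSimsun₂ n σ) * χ ((suc f ≡ᵇ i) ∧ (e ≡ᵇ j)) +
    (χ (isSimsun₂ n σ) * (f * fixedWeight) + (χ (isSimsun₂ n σ) * (e * excWeight) + χ (isSimsun₂ n σ) * (cddCount n σ * descWeight)))
  ∑-insertionWeight with isSimsun₂ n σ in simsun
  ... | false = ∑-zero insertionWeight (range₀ n) (λ m → insertionWeight-¬simsun simsun _ (∈-range₀⁻ n m))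
  ... | true  = trans (∑-insertionWeight-simsun simsun) (1*-factors (χ ((suc f ≡ᵇ i) ∧ (e ≡ᵇ j))) (f * fixedWeight) (e * excWeight) (cddCount n σ * descWeight))
    where
    1*-factors : ∀ a b c d → a + (b + (c + d)) ≡ 1 * a + (1 * b + (1 * c + 1 * d))
    1*-factors = solve-∀

-- The recurrence for the number of simsun permutations of the second kind

χ-*-cong : ∀ b {X Y} → (b ≡ true → X ≡ Y) → χ b * X ≡ χ b * Y
χ-*-cong true  X≡Y = cong (1 *_) (X≡Y refl)
χ-*-cong false _   = refl

*-χ-≡ᵇ : ∀ a c b → a * χ (b ∧ (a ≡ᵇ c)) ≡ χ (b ∧ (a ≡ᵇ c)) * c
*-χ-≡ᵇ a c false = *-zeroʳ a
*-χ-≡ᵇ a c true with a ≡ᵇ c in eq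
... | true rewrite ≡ᵇ-true⁻ {a} {c} eq = trans (*-identityʳ c) (sym (+-identityʳ c))
... | false = *-zeroʳ a

*-χ-pred-≡ᵇ : ∀ a c b → a * χ ((a ∸ 1 ≡ᵇ c) ∧ b) ≡ suc c * χ ((a ≡ᵇ suc c) ∧ b)
*-χ-pred-≡ᵇ zero    c b = sym (*-zeroʳ (suc c))
*-χ-pred-≡ᵇ (suc a) c b with a ≡ᵇ c in eq
... | true rewrite ≡ᵇ-true⁻ {a} {c} eq = refl
... | false = trans (*-zeroʳ (suc a)) (sym (*-zeroʳ (suc c)))

previous : (ℕ → ℕ → ℕ) → ℕ → ℕ → ℕ
previous C zero    j = 0
previous C (suc i) j = C i j

module _ (n : ℕ) where

  private
    C : ℕ → ℕ → ℕ
    C = simsun₂Count n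
    C≡count : ∀ i j → C i j ≡ count (simsun₂With n i j) (perms n)
    C≡count = simsun₂Count≡count n
    S : List ℕ → ℕ
    S σ = χ (isSimsun₂ n σ)
    f e : List ℕ → ℕ
    f = fixCount n
    e = excCount n
    isPerm : ∀ {σ} → σ ∈ perms n → IsPerm n σ
    isPerm = ∈perms⇒IsPerm n

  ∑-insertionWeights : ∀ i j → simsun₂Count (suc n) i j ≡
    ∑ (λ σ → S σ * χ ((suc (f σ) ≡ᵇ i) ∧ (e σ ≡ᵇ j))) (perms n) +
    (∑ (λ σ → S σ * (f σ * χ ((f σ ∸ 1 ≡ᵇ i) ∧ (suc (e σ) ≡ᵇ j)))) (perms n) +
    (∑ (λ σ → S σ * (e σ * χ ((f σ ≡ᵇ i) ∧ (e σ ≡ᵇ j)))) (perms n) +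
     ∑ (λ σ → S σ * (cddCount n σ * χ ((f σ ≡ᵇ i) ∧ (suc (e σ) ≡ᵇ j)))) (perms n)))
  ∑-insertionWeights i j = begin
    simsun₂Count (suc n) i j
      ≡⟨ simsun₂Count≡count (suc n) i j ⟩
    count (simsun₂With (suc n) i j) (perms (suc n))
      ≡⟨ ∑-perms-suc n (λ τ → χ (simsun₂With (suc n) i j τ)) ⟩
    ∑ (λ σ → ∑ (λ x → χ (simsun₂With (suc n) i j (insertMax n σ x))) (range₀ n)) (perms n)
      ≡⟨ ∑-cong _ _ (perms n) (λ m → ∑-insertionWeight (isPerm m) i j) ⟩
    ∑ (λ σ → t₁ σ + (t₂ σ + (t₃ σ + t₄ σ))) (perms n)
      ≡⟨ ∑-+⁴ t₁ t₂ t₃ t₄ (perms n) ⟩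
    ∑ t₁ (perms n) + (∑ t₂ (perms n) + (∑ t₃ (perms n) + ∑ t₄ (perms n))) ∎
    where
    open ≡-Reasoning
    t₁ t₂ t₃ t₄ : List ℕ → ℕ
    t₁ σ = S σ * χ ((suc (f σ) ≡ᵇ i) ∧ (e σ ≡ᵇ j))
    t₂ σ = S σ * (f σ * χ ((f σ ∸ 1 ≡ᵇ i) ∧ (suc (e σ) ≡ᵇ j)))
    t₃ σ = S σ * (e σ * χ ((f σ ≡ᵇ i) ∧ (e σ ≡ᵇ j)))
    t₄ σ = S σ * (cddCount n σ * χ ((f σ ≡ᵇ i) ∧ (suc (e σ) ≡ᵇ j)))

  private
    χ-simsun₂With : ∀ i j σ → χ (simsun₂With n i j σ) ≡ S σ * χ ((f σ ≡ᵇ i) ∧ (e σ ≡ᵇ j))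
    χ-simsun₂With i j σ = χ-∧ (isSimsun₂ n σ) _

  ∑-newFixedPoint : ∀ i j → ∑ (λ σ → S σ * χ ((suc (f σ) ≡ᵇ i) ∧ (e σ ≡ᵇ j))) (perms n) ≡ previous C i j
  ∑-newFixedPoint zero    j = ∑-zero _ (perms n) (λ {σ} _ → *-zeroʳ (S σ))
  ∑-newFixedPoint (suc i) j = trans (∑-cong _ _ (perms n) (λ {σ} _ → sym (χ-simsun₂With i j σ))) (sym (C≡count i j))

  ∑-noNewExcedance : ∀ (g : List ℕ → ℕ) (A : List ℕ → Bool) →
    ∑ (λ σ → S σ * (g σ * χ (A σ ∧ (suc (e σ) ≡ᵇ 0)))) (perms n) ≡ 0
  ∑-noNewExcedance g A = ∑-zero _ (perms n) λ {σ} _ →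
    trans (cong (λ b → S σ * (g σ * χ b)) (∧-zeroʳ (A σ))) (trans (cong (S σ *_) (*-zeroʳ (g σ))) (*-zeroʳ (S σ)))

  ∑-fixedPoints : ∀ i j → ∑ (λ σ → S σ * (f σ * χ ((f σ ∸ 1 ≡ᵇ i) ∧ (suc (e σ) ≡ᵇ suc j)))) (perms n) ≡ C (suc i) j * suc i
  ∑-fixedPoints i j = trans (∑-cong _ (λ σ → χ (simsun₂With n (suc i) j σ) * suc i) (perms n) (λ {σ} _ → rearrange σ))
                            (trans (∑-*ʳ _ (suc i) (perms n)) (cong (_* suc i) (sym (C≡count (suc i) j))))
    where
    swap : ∀ a b c → a * (b * c) ≡ a * c * b
    swap = solve-∀
    rearrange : ∀ σ → S σ * (f σ * χ ((f σ ∸ 1 ≡ᵇ i) ∧ (e σ ≡ᵇ j))) ≡ χ (simsun₂With n (suc i) j σ) * suc i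
    rearrange σ = trans (cong (S σ *_) (*-χ-pred-≡ᵇ (f σ) i (e σ ≡ᵇ j)))
      (trans (swap (S σ) (suc i) _) (cong (_* suc i) (sym (χ-simsun₂With (suc i) j σ))))

  ∑-excedances : ∀ i j → ∑ (λ σ → S σ * (e σ * χ ((f σ ≡ᵇ i) ∧ (e σ ≡ᵇ j)))) (perms n) ≡ C i j * j
  ∑-excedances i j = trans (∑-cong _ (λ σ → χ (simsun₂With n i j σ) * j) (perms n) (λ {σ} _ → rearrange σ))
                           (trans (∑-*ʳ _ j (perms n)) (cong (_* j) (sym (C≡count i j))))
    where
    rearrange : ∀ σ → S σ * (e σ * χ ((f σ ≡ᵇ i) ∧ (e σ ≡ᵇ j))) ≡ χ (simsun₂With n i j σ) * j
    rearrange σ = trans (cong (S σ *_) (*-χ-≡ᵇ (e σ) j (f σ ≡ᵇ i)))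
      (trans (sym (*-assoc (S σ) _ j)) (cong (_* j) (sym (χ-simsun₂With i j σ))))

  cddCount-simsun₂With : ∀ i j {σ} → σ ∈ perms n → simsun₂With n i j σ ≡ true → cddCount n σ + (i + (j + j)) ≡ n
  cddCount-simsun₂With i j {σ} m holds with ∧-true⁻ {isSimsun₂ n σ} holds
  ... | simsun , stats with ∧-true⁻ {f σ ≡ᵇ i} stats
  ... | fix≡i , exc≡j = begin
    cddCount n σ + (i + (j + j))       ≡⟨ cong₂ (λ a b → cddCount n σ + (a + (b + b))) (sym (≡ᵇ-true⁻ {f σ} fix≡i)) (sym (≡ᵇ-true⁻ {e σ} exc≡j)) ⟩
    cddCount n σ + (f σ + (e σ + e σ)) ≡⟨ rearrange (cddCount n σ) (f σ) (e σ) ⟩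
    f σ + (e σ + (cddCount n σ + e σ)) ≡⟨ cdd+2exc+fix (isPerm m) (isSimsun₂⇒¬hasCDA (isPerm m) simsun) ⟩
    n                                  ∎
    where
    open ≡-Reasoning
    rearrange : ∀ d a b → d + (a + (b + b)) ≡ a + (b + (d + b))
    rearrange = solve-∀

  ∑-cycleDoubleDescents : ∀ i j → ∑ (λ σ → S σ * (cddCount n σ * χ ((f σ ≡ᵇ i) ∧ (suc (e σ) ≡ᵇ suc j)))) (perms n)
    ≡ C i j * (n ∸ (i + (j + j)))
  ∑-cycleDoubleDescents i j =
    trans (∑-cong _ (λ σ → χ (simsun₂With n i j σ) * (n ∸ (i + (j + j)))) (perms n) rearrange)
          (trans (∑-*ʳ _ _ (perms n)) (cong (_* (n ∸ (i + (j + j)))) (sym (C≡count i j))))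
    where
    swap : ∀ a b c → a * (b * c) ≡ a * c * b
    swap = solve-∀
    rearrange : ∀ {σ} → σ ∈ perms n → S σ * (cddCount n σ * χ ((f σ ≡ᵇ i) ∧ (e σ ≡ᵇ j))) ≡ χ (simsun₂With n i j σ) * (n ∸ (i + (j + j)))
    rearrange {σ} m = trans (swap (S σ) (cddCount n σ) _)
      (trans (cong (_* cddCount n σ) (sym (χ-simsun₂With i j σ)))
        (χ-*-cong (simsun₂With n i j σ)
          (λ holds → trans (sym (m+n∸n≡m _ (i + (j + j)))) (cong (_∸ (i + (j + j))) (cddCount-simsun₂With i j m holds)))))

  count-∸-exact : ∀ i j → C i j * (n ∸ (i + (j + j))) + C i j * (i + (j + j)) ≡ C i j * n
  count-∸-exact i j = begin
    C i j * (n ∸ K) + C i j * K                                              ≡⟨ cong₂ _+_ (cong (_* (n ∸ K)) (C≡count i j)) (cong (_* K) (C≡count i j)) ⟩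
    count (simsun₂With n i j) (perms n) * (n ∸ K) + count (simsun₂With n i j) (perms n) * K ≡⟨ sym (cong₂ _+_ (∑-*ʳ _ (n ∸ K) (perms n)) (∑-*ʳ _ K (perms n))) ⟩
    ∑ (λ σ → χ (simsun₂With n i j σ) * (n ∸ K)) (perms n) + ∑ (λ σ → χ (simsun₂With n i j σ) * K) (perms n)
                                                                             ≡⟨ sym (∑-+ _ _ (perms n)) ⟩
    ∑ (λ σ → χ (simsun₂With n i j σ) * (n ∸ K) + χ (simsun₂With n i j σ) * K) (perms n)
                                                                             ≡⟨ ∑-cong _ _ (perms n) exact ⟩
    ∑ (λ σ → χ (simsun₂With n i j σ) * n) (perms n)                          ≡⟨ ∑-*ʳ _ n (perms n) ⟩
    count (simsun₂With n i j) (perms n) * n                                  ≡⟨ cong (_* n) (sym (C≡count i j)) ⟩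
    C i j * n                                                                ∎
    where
    open ≡-Reasoning
    K = i + (j + j)
    exact : ∀ {σ} → σ ∈ perms n → χ (simsun₂With n i j σ) * (n ∸ K) + χ (simsun₂With n i j σ) * K ≡ χ (simsun₂With n i j σ) * n
    exact {σ} m with simsun₂With n i j σ in holds
    ... | false = refl
    ... | true  = trans (cong₂ _+_ (*-identityˡ (n ∸ K)) (*-identityˡ K))
                    (trans (m∸n+n≡m (subst (K ≤_) (cddCount-simsun₂With i j m holds) (m≤n+m K (cddCount n σ)))) (sym (*-identityˡ n)))

  simsun₂Count-suc-zero : ∀ i → simsun₂Count (suc n) i 0 ≡ previous C i 0
  simsun₂Count-suc-zero i = begin
    simsun₂Count (suc n) i 0 ≡⟨ ∑-insertionWeights i 0 ⟩
    _                        ≡⟨ cong₂ _+_ (∑-newFixedPoint i 0) (cong₂ _+_ (∑-noNewExcedance f (λ σ → f σ ∸ 1 ≡ᵇ i))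
                                  (cong₂ _+_ (∑-excedances i 0) (∑-noNewExcedance (cddCount n) (λ σ → f σ ≡ᵇ i)))) ⟩
    previous C i 0 + (0 + (C i 0 * 0 + 0)) ≡⟨ cong (previous C i 0 +_) (trans (+-identityʳ (C i 0 * 0)) (*-zeroʳ (C i 0))) ⟩
    previous C i 0 + 0       ≡⟨ +-identityʳ _ ⟩
    previous C i 0           ∎
    where open ≡-Reasoning

  simsun₂Count-suc-suc : ∀ i j → simsun₂Count (suc n) i (suc j) ≡
    previous C i (suc j) + (C (suc i) j * suc i + (C i (suc j) * suc j + C i j * (n ∸ (i + (j + j)))))
  simsun₂Count-suc-suc i j = trans (∑-insertionWeights i (suc j))
    (cong₂ _+_ (∑-newFixedPoint i (suc j)) (cong₂ _+_ (∑-fixedPoints i j) (cong₂ _+_ (∑-excedances i (suc j)) (∑-cycleDoubleDescents i j))))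

-- The recurrence of γ

open import Data.Integer using (+_)

+-∸-scaled : ∀ c a b → c * (a ∸ b) + c * b ≡ c * a → + (c * (a ∸ b)) ≡ + c ℤ.* (+ a ℤ.- + b)
+-∸-scaled c a b exact = begin
  + (c * (a ∸ b))                             ≡⟨ cancel (+ (c * (a ∸ b))) (+ (c * b)) ⟩
  + (c * (a ∸ b)) ℤ.+ + (c * b) ℤ.- + (c * b) ≡⟨ cong (λ w → w ℤ.- + (c * b)) (trans (sym (ℤₚ.pos-+ _ (c * b))) (cong +_ exact)) ⟩
  + (c * a) ℤ.- + (c * b)                     ≡⟨ cong₂ ℤ._-_ (ℤₚ.pos-* c a) (ℤₚ.pos-* c b) ⟩
  + c ℤ.* + a ℤ.- + c ℤ.* + b                 ≡⟨ factor (+ c) (+ a) (+ b) ⟩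
  + c ℤ.* (+ a ℤ.- + b)                       ∎
  where
  open ≡-Reasoning
  cancel : ∀ (x y : ℤ) → x ≡ x ℤ.+ y ℤ.- y
  cancel = ℤ-Solver.solve-∀
  factor : ∀ (x y z : ℤ) → x ℤ.* y ℤ.- x ℤ.* z ≡ x ℤ.* (y ℤ.- z)
  factor = ℤ-Solver.solve-∀

-- The coefficient n - i - 2j + 2 of the recurrence, with j + 1 in place of j, is n - (i + 2j).
γ-coefficients : ∀ (a c₁ c₂ c₃ N I J : ℤ) →
  a ℤ.+ (+ 1 ℤ.+ I) ℤ.* c₁ ℤ.+ (+ 1 ℤ.+ J) ℤ.* c₂ ℤ.+ (((N ℤ.- I) ℤ.- + 2 ℤ.* (+ 1 ℤ.+ J)) ℤ.+ + 2) ℤ.* c₃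
  ≡ a ℤ.+ (c₁ ℤ.* (+ 1 ℤ.+ I) ℤ.+ (c₂ ℤ.* (+ 1 ℤ.+ J) ℤ.+ c₃ ℤ.* (N ℤ.- (I ℤ.+ (J ℤ.+ J)))))
γ-coefficients = ℤ-Solver.solve-∀

γprev-i-previous : ∀ {g : ℕ → ℕ → ℤ} {C : ℕ → ℕ → ℕ} → (∀ i j → g i j ≡ + C i j) →
  ∀ i j → γprev-i g i j ≡ + previous C i j
γprev-i-previous g≡C zero    j = refl
γprev-i-previous g≡C (suc i) j = g≡C i j

simsun₂Count-suc-sucℤ : ∀ n i j → + simsun₂Count (suc n) i (suc j) ≡
  + previous (simsun₂Count n) i (suc j) ℤ.+
  (+ simsun₂Count n (suc i) j ℤ.* (+ 1 ℤ.+ + i) ℤ.+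
   (+ simsun₂Count n i (suc j) ℤ.* (+ 1 ℤ.+ + j) ℤ.+ + simsun₂Count n i j ℤ.* (+ n ℤ.- (+ i ℤ.+ (+ j ℤ.+ + j)))))
simsun₂Count-suc-sucℤ n i j = begin
  + simsun₂Count (suc n) i (suc j)
    ≡⟨ cong +_ (simsun₂Count-suc-suc n i j) ⟩
  + (previous C i (suc j) + (C (suc i) j * suc i + (C i (suc j) * suc j + C i j * (n ∸ K))))
    ≡⟨ trans (ℤₚ.pos-+ (previous C i (suc j)) _) (cong (λ w → + previous C i (suc j) ℤ.+ w) (trans (ℤₚ.pos-+ (C (suc i) j * suc i) _)
         (cong (λ w → + (C (suc i) j * suc i) ℤ.+ w) (ℤₚ.pos-+ (C i (suc j) * suc j) (C i j * (n ∸ K)))))) ⟩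
  + previous C i (suc j) ℤ.+ (+ (C (suc i) j * suc i) ℤ.+ (+ (C i (suc j) * suc j) ℤ.+ + (C i j * (n ∸ K))))
    ≡⟨ cong (λ w → + previous C i (suc j) ℤ.+ w) (cong₂ ℤ._+_ (scaled (C (suc i) j) i) (cong₂ ℤ._+_ (scaled (C i (suc j)) j) lastTerm)) ⟩
  _ ∎
  where
  open ≡-Reasoning
  C = simsun₂Count n
  K = i + (j + j)
  scaled : ∀ c k → + (c * suc k) ≡ + c ℤ.* (+ 1 ℤ.+ + k)
  scaled c k = trans (ℤₚ.pos-* c (suc k)) (cong (λ w → + c ℤ.* w) (ℤₚ.pos-+ 1 k))
  lastTerm : + (C i j * (n ∸ K)) ≡ + C i j ℤ.* (+ n ℤ.- (+ i ℤ.+ (+ j ℤ.+ + j)))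
  lastTerm = trans (+-∸-scaled (C i j) n K (count-∸-exact n i j))
                   (cong (λ w → + C i j ℤ.* (+ n ℤ.- w)) (trans (ℤₚ.pos-+ i (j + j)) (cong (λ w → + i ℤ.+ w) (ℤₚ.pos-+ j j))))

γ≡simsun₂Count : ∀ n i j → γ n i j ≡ + simsun₂Count n i j
γ≡simsun₂Count zero    zero    zero    = refl
γ≡simsun₂Count zero    zero    (suc j) = refl
γ≡simsun₂Count zero    (suc i) j       = refl
γ≡simsun₂Count (suc n) i       zero    = begin
  γprev-i (γ n) i 0 ℤ.+ + 0 ℤ.* γ n i 0 ≡⟨ cong₂ ℤ._+_ (γprev-i-previous (γ≡simsun₂Count n) i 0) (ℤₚ.*-zeroˡ (γ n i 0)) ⟩
  + previous (simsun₂Count n) i 0 ℤ.+ + 0 ≡⟨ ℤₚ.+-identityʳ _ ⟩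
  + previous (simsun₂Count n) i 0       ≡⟨ cong +_ (sym (simsun₂Count-suc-zero n i)) ⟩
  + simsun₂Count (suc n) i 0            ∎
  where open ≡-Reasoning
γ≡simsun₂Count (suc n) i       (suc j) = begin
  γ (suc n) i (suc j)
    ≡⟨ cong₂ ℤ._+_ (cong₂ ℤ._+_ (cong₂ ℤ._+_ (γprev-i-previous (γ≡simsun₂Count n) i (suc j))
                                              (cong₂ ℤ._*_ (ℤₚ.pos-+ 1 i) (γ≡simsun₂Count n (suc i) j)))
                                (cong₂ ℤ._*_ (ℤₚ.pos-+ 1 j) (γ≡simsun₂Count n i (suc j))))
                   (cong₂ ℤ._*_ (cong (λ w → ((+ n ℤ.- + i) ℤ.- w) ℤ.+ + 2) (trans (ℤₚ.pos-* 2 (suc j)) (cong (λ w → + 2 ℤ.* w) (ℤₚ.pos-+ 1 j))))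
                                (γ≡simsun₂Count n i j)) ⟩
  a ℤ.+ (+ 1 ℤ.+ + i) ℤ.* c₁ ℤ.+ (+ 1 ℤ.+ + j) ℤ.* c₂ ℤ.+ (((+ n ℤ.- + i) ℤ.- + 2 ℤ.* (+ 1 ℤ.+ + j)) ℤ.+ + 2) ℤ.* c₃
    ≡⟨ γ-coefficients a c₁ c₂ c₃ (+ n) (+ i) (+ j) ⟩
  a ℤ.+ (c₁ ℤ.* (+ 1 ℤ.+ + i) ℤ.+ (c₂ ℤ.* (+ 1 ℤ.+ + j) ℤ.+ c₃ ℤ.* (+ n ℤ.- (+ i ℤ.+ (+ j ℤ.+ + j)))))
    ≡⟨ sym (simsun₂Count-suc-sucℤ n i j) ⟩
  + simsun₂Count (suc n) i (suc j) ∎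
  where
  open ≡-Reasoning
  a = + previous (simsun₂Count n) i (suc j)
  c₁ = + simsun₂Count n (suc i) j
  c₂ = + simsun₂Count n i (suc j)
  c₃ = + simsun₂Count n i j

-- The identity holds for all i and j.
proposition3p7 : (n i j : ℕ) → i ≤ n → j ≤ (n ∸ i) / 2 →
    γ n i j ≡ + simsun₂Count n i j
proposition3p7 n i j _ _ = γ≡simsun₂Count n i j
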